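{- Let $g(1)<g(2)<g(3)<\cdots$ be the increasing enumeration of the positive integers whose canonical Tribonacci representation ends in the digit $1$ (so $g(1)=1,g(2)=3,g(3)=5,g(4)=8,\dots$). Then \[\lim_{r\to\infty}\frac{g(r)}{r}=\frac{\alpha^2+1}{2}=\frac{\alpha}{\alpha-1}.\]
   Context: Tribonacci numbers: $T_0=0$, $T_1=0$, $T_2=1$, $T_n=T_{n-1}+T_{n-2}+T_{n-3}$ for $n\ge 3$. Every nonnegative integer $N$ has a unique canonical Tribonacci representation $N=\sum_i d_iT_{i+3}$ with digits $d_i\in\{0,1\}$ and no three consecutive digits equal to $1$; it is written as the binary word $d_k\cdots d_1d_0$, the last digit $d_0$ being the coefficient of $T_3=1$. $\alpha$ is the real root of $x^3-x^2-x-1$. -}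

module Defs where

open import Data.Nat as ℕ using (ℕ; zero; suc)
open import Data.Bool using (Bool; true; false; if_then_else_)
open import Data.List using (List; []; _∷_)
open import Data.Product using (Σ; _×_; ∃)
open import Data.Empty using (⊥)
open import Data.Unit using (⊤)
open import Data.Integer using (+_)
open import Data.Rational using (ℚ; _<_; _≤_; _+_; _*_; _-_; ½; 1ℚ; 0ℚ; _/_)
open import Relation.Binary.PropositionalEquality using (_≡_)

T : ℕ → ℕ
T 0 = 0
T 1 = 0
T 2 = 1
T (suc (suc (suc n))) = T (suc (suc n)) ℕ.+ T (suc n) ℕ.+ T n

-- Digit words are lists of Bool, LEAST significant digit first:
-- the list d₀ ∷ d₁ ∷ … ∷ dₖ denotes Σ dᵢ T (i + 3).
valFrom : ℕ → List Bool → ℕ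
valFrom i [] = 0
valFrom i (d ∷ ds) = (if d then T (i ℕ.+ 3) else 0) ℕ.+ valFrom (suc i) ds

val : List Bool → ℕ
val = valFrom 0

No111 : List Bool → Set
No111 (true ∷ true ∷ true ∷ _) = ⊥
No111 [] = ⊤
No111 (_ ∷ ds) = No111 ds

-- the canonical Tribonacci representation of N ends in the digit 1
-- (d₀ = 1); canonical representations are unique up to leading zeros
EndsIn1 : ℕ → Set
EndsIn1 N = Σ (List Bool) λ ds → No111 (true ∷ ds) × val (true ∷ ds) ≡ N

-- α : the real root of x³ - x² - x - 1, given by its Dedekind cut
-- (the cubic is negative exactly left of α and positive exactly right of α)
BelowAlpha : ℚ → Set
BelowAlpha p = p * p * p < p * p + p + 1ℚ

AboveAlpha : ℚ → Set
AboveAlpha q = q * q + q + 1ℚ < q * q * q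

-- Cut of L₁ = (α² + 1) / 2  (x ↦ (x²+1)/2 is increasing on x ≥ 0, α > 0)
BelowL₁ : ℚ → Set
BelowL₁ a = Σ ℚ λ p → 0ℚ ≤ p × BelowAlpha p × a < ½ * (p * p + 1ℚ)

AboveL₁ : ℚ → Set
AboveL₁ b = Σ ℚ λ q → AboveAlpha q × ½ * (q * q + 1ℚ) < b

-- Cut of L₂ = α / (α - 1)  (x ↦ x/(x-1) is decreasing on x > 1, α > 1);
-- for x > 1, "c < x/(x-1)" is written c * (x - 1) < x and
-- "x/(x-1) < c" is written x < c * (x - 1).
BelowL₂ : ℚ → Set
BelowL₂ a = Σ ℚ λ q → AboveAlpha q × 1ℚ < q × a * (q - 1ℚ) < q

AboveL₂ : ℚ → Set
AboveL₂ b = Σ ℚ λ p → BelowAlpha p × 1ℚ < p × p < b * (p - 1ℚ)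

ConvergesTo : (ℕ → ℚ) → (ℚ → Set) → (ℚ → Set) → Set
ConvergesTo f Below Above =
  (a b : ℚ) → Below a → Above b →
  Σ ℕ λ R → (k : ℕ) → R ℕ.≤ k → (a < f k × f k < b)

-- the sequence g(r)/r, reindexed as k ↦ g(k+1)/(k+1)
ratio : (ℕ → ℕ) → ℕ → ℚ
ratio g k = (+ g (suc k)) / suc k

-- Let count N be the number of 1 ≤ j ≤ N whose representation ends in 1, so
-- that count (g r) = r.  For n ≥ 1 and m < T (2 + n) + T (1 + n), removing the
-- top digit of T (3 + n) + m leaves the representation of m, so count is
-- additive along the greedy decomposition N = T (3 + n) + m, and
-- count (T (3 + n)) = T (3 + n) − T (2 + n).  Since T (3 + n) / T (2 + n) → α,
-- additivity spreads count N / N → 1 − 1/α to all N; hence g r / r → α / (α − 1),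
-- which equals (α² + 1) / 2.  As there are no reals, α is approached by
-- rationals c / d on either side: iterating x ↦ 1 + 1/x + 1/x² on bounds of
-- T (1 + n) / T n shrinks their cubic defect geometrically, so the ratio
-- eventually passes every such c / d.

module Submission where

open import Defs
open import Data.Nat
open import Data.Nat.Properties
open import Data.Nat.Induction using (<-rec)
open import Data.Nat.Coprimality using (Coprime)
open import Data.Nat.Tactic.RingSolver using (solve-∀)
open import Data.Integer as ℤ using (ℤ; +_; -[1+_])
import Data.Integer.Properties as ℤP
open import Data.Integer.GCD using () renaming (gcd to gcdℤ)
import Data.Integer.Tactic.RingSolver as ℤ-Solver
open import Data.Rational as ℚ using (ℚ; mkℚ; ↥_; ↧_)
import Data.Rational.Properties as ℚP
import Data.Rational.Unnormalised as ℚᵘ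
import Data.Rational.Unnormalised.Properties as ℚᵘP
open import Data.Bool using (Bool; true; false; if_then_else_) renaming (T to True)
open import Data.List using (List; []; _∷_; _++_; length; replicate)
open import Data.List.Properties using (length-++; ++-assoc)
open import Data.Product using (Σ; _×_; _,_; proj₁; proj₂)
open import Data.Empty using (⊥-elim)
open import Data.Unit using (tt)
open import Function using (_∘_)
open import Relation.Binary.PropositionalEquality
open import Relation.Binary.Definitions using (tri<; tri≈; tri>)
open import Relation.Nullary using (¬_; Dec; yes; no)
open import Relation.Nullary.Decidable using (map′)

open ≤-Reasoning

-- Tribonacci numbers

suc-mono⇒mono-≤ : (f : ℕ → ℕ) → (∀ n → f n ≤ f (suc n)) → ∀ {m n} → m ≤ n → f m ≤ f n
suc-mono⇒mono-≤ f step m≤n = go (≤⇒≤′ m≤n)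
  where
  go : ∀ {m n} → m ≤′ n → f m ≤ f n
  go ≤′-refl = ≤-refl
  go (≤′-step p) = ≤-trans (go p) (step _)

T-≤-suc : ∀ n → T n ≤ T (suc n)
T-≤-suc 0 = z≤n
T-≤-suc 1 = z≤n
T-≤-suc 2 = ≤-refl
T-≤-suc (suc (suc (suc n))) = ≤-trans (m≤m+n _ (T (suc (suc n)))) (m≤m+n _ (T (suc n)))

T-mono-≤ : ∀ {m n} → m ≤ n → T m ≤ T n
T-mono-≤ = suc-mono⇒mono-≤ T T-≤-suc

1≤T[2+n] : ∀ n → 1 ≤ T (2 + n)
1≤T[2+n] n = T-mono-≤ {2} {2 + n} (s≤s (s≤s z≤n))

-- T (4 + n) = T (3 + n) + width n: the numbers with top digit at position n
-- are T (3 + n) + m with m < width n.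
width : ℕ → ℕ
width n = T (2 + n) + T (1 + n)

T[4+n]≡T[3+n]+width : ∀ n → T (4 + n) ≡ T (3 + n) + width n
T[4+n]≡T[3+n]+width n = +-assoc (T (3 + n)) (T (2 + n)) (T (1 + n))

width≤T[3+n] : ∀ n → width n ≤ T (3 + n)
width≤T[3+n] n = m≤m+n (width n) (T n)

1≤width : ∀ n → 1 ≤ width n
1≤width n = ≤-trans (1≤T[2+n] n) (m≤m+n _ _)

T[3+n]<T[4+n] : ∀ n → T (3 + n) < T (4 + n)
T[3+n]<T[4+n] n = begin-strict
  T (3 + n)          <⟨ m<m+n (T (3 + n)) (1≤width n) ⟩
  T (3 + n) + width n ≡⟨ T[4+n]≡T[3+n]+width n ⟨
  T (4 + n)          ∎

n<T[3+n] : ∀ n → n < T (3 + n)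
n<T[3+n] zero = s≤s z≤n
n<T[3+n] (suc n) = ≤-<-trans (n<T[3+n] n) (T[3+n]<T[4+n] n)

-- The top digit of N sits at position n.
Bracket : ℕ → ℕ → Set
Bracket n N = T (3 + n) ≤ N × N < T (4 + n)

bracket-unique : ∀ {ℓ n N} → Bracket ℓ N → Bracket n N → ℓ ≡ n
bracket-unique {ℓ} {n} (ℓ≤ , <ℓ) (n≤ , <n) with <-cmp ℓ n
... | tri< ℓ<n _ _ = ⊥-elim (<⇒≱ <ℓ (≤-trans (T-mono-≤ (s≤s (s≤s (s≤s ℓ<n)))) n≤))
... | tri≈ _ ℓ≡n _ = ℓ≡n
... | tri> _ _ n<ℓ = ⊥-elim (<⇒≱ <n (≤-trans (T-mono-≤ (s≤s (s≤s (s≤s n<ℓ)))) ℓ≤))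

bracket : ∀ N → 1 ≤ N → Σ ℕ λ n → Bracket n N
bracket (suc zero) _ = 0 , ≤-refl , s≤s (s≤s z≤n)
bracket (suc (suc N)) _ with bracket (suc N) (s≤s z≤n)
... | n , lo , hi with suc (suc N) <? T (4 + n)
...   | yes below = n , ≤-trans lo (n≤1+n _) , below
...   | no notBelow = suc n , ≮⇒≥ notBelow , (begin-strict
          suc (suc N) ≤⟨ hi ⟩
          T (4 + n)   <⟨ T[3+n]<T[4+n] (suc n) ⟩
          T (5 + n)   ∎)

-- Digit words

valFrom-true : ∀ i ds → valFrom i (true ∷ ds) ≡ T (3 + i) + valFrom (suc i) ds
valFrom-true i ds = cong (λ k → T k + valFrom (suc i) ds) (+-comm i 3)

valFrom-++ : ∀ i xs ys → valFrom i (xs ++ ys) ≡ valFrom i xs + valFrom (i + length xs) ys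
valFrom-++ i [] ys = cong (λ k → valFrom k ys) (sym (+-identityʳ i))
valFrom-++ i (x ∷ xs) ys rewrite valFrom-++ (suc i) xs ys | +-suc i (length xs) =
  sym (+-assoc (if x then T (i + 3) else 0) (valFrom (suc i) xs) _)

valFrom-zeros : ∀ i k → valFrom i (replicate k false) ≡ 0
valFrom-zeros i zero = refl
valFrom-zeros i (suc k) = valFrom-zeros (suc i) k

valFrom-zeros-true : ∀ i o → valFrom i (replicate o false ++ true ∷ []) ≡ T (3 + (i + o))
valFrom-zeros-true i zero = trans (+-identityʳ _) (cong T (trans (+-comm i 3) (cong (_+_ 3) (sym (+-identityʳ i)))))
valFrom-zeros-true i (suc o) = trans (valFrom-zeros-true (suc i) o) (cong (λ k → T (3 + k)) (sym (+-suc i o)))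

No111-++⁻ˡ : ∀ xs ys → No111 (xs ++ ys) → No111 xs
No111-++⁻ˡ [] ys h = tt
No111-++⁻ˡ (false ∷ []) ys h = tt
No111-++⁻ˡ (true ∷ []) ys h = tt
No111-++⁻ˡ (false ∷ false ∷ []) ys h = tt
No111-++⁻ˡ (false ∷ true ∷ []) ys h = tt
No111-++⁻ˡ (true ∷ false ∷ []) ys h = tt
No111-++⁻ˡ (true ∷ true ∷ []) ys h = tt
No111-++⁻ˡ (false ∷ y ∷ z ∷ r) ys h = No111-++⁻ˡ (y ∷ z ∷ r) ys h
No111-++⁻ˡ (true ∷ false ∷ z ∷ r) ys h = No111-++⁻ˡ (false ∷ z ∷ r) ys h
No111-++⁻ˡ (true ∷ true ∷ false ∷ r) ys h = No111-++⁻ˡ (true ∷ false ∷ r) ys h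

No111-++-false∷ : ∀ xs zs → No111 xs → No111 (false ∷ zs) → No111 (xs ++ false ∷ zs)
No111-++-false∷ [] zs _ h = h
No111-++-false∷ (false ∷ []) zs _ h = h
No111-++-false∷ (true ∷ []) zs _ h = h
No111-++-false∷ (false ∷ false ∷ []) zs _ h = h
No111-++-false∷ (false ∷ true ∷ []) zs _ h = h
No111-++-false∷ (true ∷ false ∷ []) zs _ h = h
No111-++-false∷ (true ∷ true ∷ []) zs _ h = h
No111-++-false∷ (false ∷ y ∷ z ∷ r) zs g h = No111-++-false∷ (y ∷ z ∷ r) zs g h
No111-++-false∷ (true ∷ false ∷ z ∷ r) zs g h = No111-++-false∷ (false ∷ z ∷ r) zs g h
No111-++-false∷ (true ∷ true ∷ false ∷ r) zs g h = No111-++-false∷ (true ∷ false ∷ r) zs g h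

No111-∷ʳ-true : ∀ xs → No111 xs → (∀ us → xs ≢ us ++ true ∷ true ∷ []) → No111 (xs ++ true ∷ [])
No111-∷ʳ-true [] _ _ = tt
No111-∷ʳ-true (false ∷ []) _ _ = tt
No111-∷ʳ-true (true ∷ []) _ _ = tt
No111-∷ʳ-true (false ∷ false ∷ []) _ _ = tt
No111-∷ʳ-true (false ∷ true ∷ []) _ _ = tt
No111-∷ʳ-true (true ∷ false ∷ []) _ _ = tt
No111-∷ʳ-true (true ∷ true ∷ []) _ not11 = ⊥-elim (not11 [] refl)
No111-∷ʳ-true (false ∷ y ∷ z ∷ r) h not11 =
  No111-∷ʳ-true (y ∷ z ∷ r) h (λ us e → not11 (false ∷ us) (cong (false ∷_) e))
No111-∷ʳ-true (true ∷ false ∷ z ∷ r) h not11 =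
  No111-∷ʳ-true (false ∷ z ∷ r) h (λ us e → not11 (true ∷ us) (cong (true ∷_) e))
No111-∷ʳ-true (true ∷ true ∷ false ∷ r) h not11 =
  No111-∷ʳ-true (true ∷ false ∷ r) h (λ us e → not11 (true ∷ us) (cong (true ∷_) e))

No111-zeros-true : ∀ k → No111 (replicate k false ++ true ∷ [])
No111-zeros-true zero = tt
No111-zeros-true (suc k) = No111-zeros-true k

-- An admissible word of length ℓ is worth less than T (3 + ℓ).  To run the
-- induction from the least significant digit, the bound is strengthened by
-- room j ds: any admissible word below position j that can precede ds is
-- worth less than room j ds.
room : ℕ → List Bool → ℕ
room j (true ∷ true ∷ _) = T (2 + j)
room j (true ∷ _) = T (2 + j) + T (1 + j)
room j _ = T (3 + j)

T[3+j]≤room : ∀ j ds → T (3 + j) ≤ room (suc j) ds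
T[3+j]≤room j [] = T-≤-suc (3 + j)
T[3+j]≤room j (false ∷ _) = T-≤-suc (3 + j)
T[3+j]≤room j (true ∷ []) = m≤m+n _ _
T[3+j]≤room j (true ∷ false ∷ _) = m≤m+n _ _
T[3+j]≤room j (true ∷ true ∷ _) = ≤-refl

valFrom+room≤T : ∀ j ds → No111 ds → valFrom j ds + room j ds ≤ T (3 + (length ds + j))
valFrom+room≤T j [] _ = ≤-refl
valFrom+room≤T j (false ∷ r) h = begin
  valFrom (suc j) r + T (3 + j)      ≤⟨ +-monoʳ-≤ _ (T[3+j]≤room j r) ⟩
  valFrom (suc j) r + room (suc j) r ≤⟨ valFrom+room≤T (suc j) r h ⟩
  T (3 + (length r + suc j))        ≡⟨ cong (λ i → T (3 + i)) (+-suc (length r) j) ⟩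
  T (3 + suc (length r + j))        ∎
valFrom+room≤T j (true ∷ []) _ = ≤-reflexive (begin-equality
  valFrom j (true ∷ []) + width j       ≡⟨ cong (_+ width j) (valFrom-true j []) ⟩
  T (3 + j) + 0 + width j               ≡⟨ cong (_+ width j) (+-identityʳ (T (3 + j))) ⟩
  T (3 + j) + width j                   ≡⟨ T[4+n]≡T[3+n]+width j ⟨
  T (4 + j)                             ∎)
valFrom+room≤T j (true ∷ false ∷ r) h = begin
  valFrom j (true ∷ false ∷ r) + width j     ≡⟨ cong (_+ width j) (valFrom-true j (false ∷ r)) ⟩
  T (3 + j) + valFrom (2 + j) r + width j   ≡⟨ shuffle (T (3 + j)) (valFrom (2 + j) r) (T (2 + j)) (T (1 + j)) ⟩
  valFrom (2 + j) r + T (4 + j)             ≤⟨ valFrom+room≤T (suc j) (false ∷ r) h ⟩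
  T (3 + (suc (length r) + suc j))          ≡⟨ cong (λ i → T (3 + i)) (+-suc (suc (length r)) j) ⟩
  T (3 + (2 + length r + j))                ∎
  where
  shuffle : ∀ a b c d → a + b + (c + d) ≡ b + (a + c + d)
  shuffle = solve-∀
valFrom+room≤T j (true ∷ true ∷ []) _ = ≤-reflexive (begin-equality
  valFrom j (true ∷ true ∷ []) + T (2 + j)        ≡⟨ cong (_+ T (2 + j)) (valFrom-true j (true ∷ [])) ⟩
  T (3 + j) + valFrom (suc j) (true ∷ []) + T (2 + j)
    ≡⟨ cong (λ v → T (3 + j) + v + T (2 + j)) (valFrom-true (suc j) []) ⟩
  T (3 + j) + (T (4 + j) + 0) + T (2 + j)          ≡⟨ shuffle (T (3 + j)) (T (4 + j)) (T (2 + j)) ⟩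
  T (5 + j)                                        ∎)
  where
  shuffle : ∀ a b c → a + (b + 0) + c ≡ b + a + c
  shuffle = solve-∀
valFrom+room≤T j (true ∷ true ∷ false ∷ r) h = begin
  valFrom j (true ∷ true ∷ false ∷ r) + T (2 + j)
    ≡⟨ cong (_+ T (2 + j)) (valFrom-true j (true ∷ false ∷ r)) ⟩
  T (3 + j) + valFrom (suc j) (true ∷ false ∷ r) + T (2 + j)
    ≡⟨ cong (λ v → T (3 + j) + v + T (2 + j)) (valFrom-true (suc j) (false ∷ r)) ⟩
  T (3 + j) + (T (4 + j) + valFrom (3 + j) r) + T (2 + j)
    ≡⟨ shuffle (T (3 + j)) (T (4 + j)) (valFrom (3 + j) r) (T (2 + j)) ⟩
  valFrom (3 + j) r + T (5 + j)                   ≤⟨ valFrom+room≤T (2 + j) (false ∷ r) h ⟩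
  T (3 + (suc (length r) + (2 + j)))              ≡⟨ cong (λ i → T (3 + i)) (shift (length r) j) ⟩
  T (3 + (3 + length r + j))                      ∎
  where
  shuffle : ∀ a b c d → a + (b + c) + d ≡ c + (b + a + d)
  shuffle = solve-∀
  shift : ∀ ℓ j → suc ℓ + (2 + j) ≡ 3 + ℓ + j
  shift = solve-∀

val<T : ∀ ds → No111 ds → val ds < T (3 + length ds)
val<T ds h = begin-strict
  val ds                  <⟨ m<m+n (val ds) (room-0 ds) ⟩
  val ds + room 0 ds      ≤⟨ valFrom+room≤T 0 ds h ⟩
  T (3 + (length ds + 0)) ≡⟨ cong (λ i → T (3 + i)) (+-identityʳ (length ds)) ⟩
  T (3 + length ds)       ∎
  where
  room-0 : ∀ ds → 1 ≤ room 0 ds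
  room-0 [] = ≤-refl
  room-0 (false ∷ _) = ≤-refl
  room-0 (true ∷ []) = ≤-refl
  room-0 (true ∷ false ∷ _) = ≤-refl
  room-0 (true ∷ true ∷ _) = ≤-refl

lastOne : ∀ ds → Σ (List Bool) λ u → Σ ℕ λ k → true ∷ ds ≡ u ++ true ∷ replicate k false
lastOne [] = [] , 0 , refl
lastOne (true ∷ ds) with lastOne ds
... | u , k , e = true ∷ u , k , cong (true ∷_) e
lastOne (false ∷ ds) with lastOne ds
... | [] , k , refl = [] , suc k , refl
... | true ∷ u , k , refl = true ∷ false ∷ u , k , refl

val-top : ∀ u Y → val (u ++ true ∷ Y) ≡ val u + T (3 + length u) + valFrom (suc (length u)) Y
val-top u Y = begin-equality
  val (u ++ true ∷ Y)                                  ≡⟨ valFrom-++ 0 u (true ∷ Y) ⟩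
  val u + valFrom (length u) (true ∷ Y)                ≡⟨ cong (_+_ (val u)) (valFrom-true (length u) Y) ⟩
  val u + (T (3 + length u) + valFrom (suc (length u)) Y) ≡⟨ +-assoc (val u) _ _ ⟨
  val u + T (3 + length u) + valFrom (suc (length u)) Y ∎

val-top-zeros : ∀ u k → val (u ++ true ∷ replicate k false) ≡ val u + T (3 + length u)
val-top-zeros u k = trans (val-top u (replicate k false))
  (trans (cong (_+_ (val u + T (3 + length u))) (valFrom-zeros (suc (length u)) k)) (+-identityʳ _))

No111-top : ∀ u k → No111 (u ++ true ∷ replicate k false) → No111 (u ++ true ∷ [])
No111-top u k h = No111-++⁻ˡ (u ++ true ∷ []) (replicate k false)
  (subst No111 (sym (++-assoc u (true ∷ []) (replicate k false))) h)

top-bracket : ∀ u k → No111 (u ++ true ∷ replicate k false) →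
  Bracket (length u) (val (u ++ true ∷ replicate k false))
top-bracket u k h rewrite val-top-zeros u k = m≤n+m _ (val u) , (begin-strict
  val u + T (3 + length u)        ≡⟨ val-top-zeros u 0 ⟨
  val (u ++ true ∷ [])            <⟨ val<T (u ++ true ∷ []) (No111-top u k h) ⟩
  T (3 + length (u ++ true ∷ [])) ≡⟨ cong (λ i → T (3 + i)) (trans (length-++ u) (+-comm (length u) 1)) ⟩
  T (4 + length u)                ∎)

T+width-bracket : ∀ n m → m < width n → Bracket n (T (3 + n) + m)
T+width-bracket n m m<w = m≤m+n _ m , (begin-strict
  T (3 + n) + m       <⟨ +-monoʳ-< (T (3 + n)) m<w ⟩
  T (3 + n) + width n ≡⟨ T[4+n]≡T[3+n]+width n ⟨
  T (4 + n)           ∎)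

below-top : ∀ {ds} u k → true ∷ ds ≡ u ++ true ∷ replicate k false → 1 ≤ length u →
  No111 (u ++ true ∷ replicate k false) → EndsIn1 (val u)
below-top (true ∷ u) k refl _ h = u , No111-++⁻ˡ (true ∷ u) _ h , refl

EndsIn1-drop-top : ∀ {n m} → 1 ≤ n → m < width n → EndsIn1 (T (3 + n) + m) → EndsIn1 m
EndsIn1-drop-top {n} {m} 1≤n m<w (ds , h , v) with lastOne ds
... | u , k , e = subst EndsIn1 val-u≡m (below-top u k e (subst (1 ≤_) (sym ℓ≡n) 1≤n) h′)
  where
  h′ : No111 (u ++ true ∷ replicate k false)
  h′ = subst No111 e h
  v′ : val (u ++ true ∷ replicate k false) ≡ T (3 + n) + m
  v′ = trans (cong val (sym e)) v
  ℓ≡n : length u ≡ n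
  ℓ≡n = bracket-unique (subst (Bracket (length u)) v′ (top-bracket u k h′)) (T+width-bracket n m m<w)
  val-u≡m : val u ≡ m
  val-u≡m = +-cancelʳ-≡ (T (3 + n)) (val u) m (begin-equality
    val u + T (3 + n)          ≡⟨ cong (λ i → val u + T (3 + i)) ℓ≡n ⟨
    val u + T (3 + length u)   ≡⟨ trans (sym (val-top-zeros u k)) v′ ⟩
    T (3 + n) + m              ≡⟨ +-comm (T (3 + n)) m ⟩
    m + T (3 + n)              ∎)

starts-true : ∀ {ds} u Z Y → true ∷ ds ≡ u ++ true ∷ Z → Σ (List Bool) λ ds′ → u ++ true ∷ Y ≡ true ∷ ds′
starts-true [] Z Y _ = Y , refl
starts-true (true ∷ u) Z Y refl = u ++ true ∷ Y , refl

width≤val-11 : ∀ us → width (2 + length us) ≤ val (us ++ true ∷ true ∷ [])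
width≤val-11 us = begin
  T (4 + ℓ) + T (3 + ℓ)                  ≡⟨ +-comm (T (4 + ℓ)) (T (3 + ℓ)) ⟩
  T (3 + ℓ) + T (4 + ℓ)                  ≤⟨ m≤n+m _ (val us) ⟩
  val us + (T (3 + ℓ) + T (4 + ℓ))       ≡⟨ +-assoc (val us) _ _ ⟨
  val us + T (3 + ℓ) + T (4 + ℓ)         ≡⟨ cong (_+_ (val us + T (3 + ℓ))) (trans (valFrom-true (suc ℓ) []) (+-identityʳ _)) ⟨
  val us + T (3 + ℓ) + valFrom (suc ℓ) (true ∷ []) ≡⟨ val-top us (true ∷ []) ⟨
  val (us ++ true ∷ true ∷ [])           ∎
  where
  ℓ = length us

No111-raise : ∀ u o → No111 (u ++ true ∷ []) → (o ≡ 0 → ∀ us → u ++ true ∷ [] ≢ us ++ true ∷ true ∷ []) →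
  No111 (u ++ true ∷ replicate o false ++ true ∷ [])
No111-raise u zero hu not-11 = subst No111 (++-assoc u (true ∷ []) (true ∷ []))
  (No111-∷ʳ-true (u ++ true ∷ []) hu (not-11 refl))
No111-raise u (suc o) hu _ = subst No111 (++-assoc u (true ∷ []) _)
  (No111-++-false∷ (u ++ true ∷ []) _ hu (No111-zeros-true o))

top<width⇒< : ∀ {ℓ n m} → T (3 + ℓ) ≤ m → m < width n → ℓ < n
top<width⇒< {ℓ} {n} {m} T≤m m<w with n ≤? ℓ
... | no n≰ℓ = ≰⇒> n≰ℓ
... | yes n≤ℓ = ⊥-elim (<⇒≱ m<w (begin
  width n    ≤⟨ width≤T[3+n] n ⟩
  T (3 + n)  ≤⟨ T-mono-≤ (+-monoʳ-≤ 3 n≤ℓ) ⟩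
  T (3 + ℓ)  ≤⟨ T≤m ⟩
  m          ∎))

EndsIn1-add-top : ∀ {n m} → 1 ≤ n → m < width n → EndsIn1 m → EndsIn1 (T (3 + n) + m)
EndsIn1-add-top {n} {m} 1≤n m<w (ds , h , v) with lastOne ds
... | u , k , e = raise (proj₂ (m≤n⇒∃[o]m+o≡n (top<width⇒< (subst (T (3 + ℓ) ≤_) v′ (m≤n+m _ (val u))) m<w)))
  where
  ℓ = length u
  v′ : val u + T (3 + ℓ) ≡ m
  v′ = trans (sym (val-top-zeros u k)) (trans (cong val (sym e)) v)
  -- The new top digit sits next to the old one only when n = ℓ + 1; then a
  -- third 1 below them would force m ≥ width n.
  not-11 : suc ℓ ≡ n → ∀ us → u ++ true ∷ [] ≢ us ++ true ∷ true ∷ []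
  not-11 ℓ+1≡n us e₁₁ = <⇒≱ m<w (begin
    width n                       ≡⟨ cong width (trans (sym ℓ+1≡n) (cong suc ℓ≡)) ⟩
    width (2 + length us)         ≤⟨ width≤val-11 us ⟩
    val (us ++ true ∷ true ∷ [])  ≡⟨ cong val e₁₁ ⟨
    val (u ++ true ∷ [])          ≡⟨ val-top-zeros u 0 ⟩
    val u + T (3 + ℓ)             ≡⟨ v′ ⟩
    m                             ∎)
    where
    ℓ≡ : ℓ ≡ suc (length us)
    ℓ≡ = suc-injective (trans (+-comm 1 ℓ) (trans (sym (length-++ u))
           (trans (cong length e₁₁) (trans (length-++ us) (+-comm (length us) 2)))))
  raise : ∀ {o} → suc ℓ + o ≡ n → EndsIn1 (T (3 + n) + m)
  raise {o} eq with starts-true u _ (replicate o false ++ true ∷ []) e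
  ... | ds′ , e′ = ds′ , subst No111 e′ admissible , (begin-equality
    val (true ∷ ds′)                                  ≡⟨ cong val e′ ⟨
    val (u ++ true ∷ replicate o false ++ true ∷ [])  ≡⟨ val-top u _ ⟩
    val u + T (3 + ℓ) + valFrom (suc ℓ) (replicate o false ++ true ∷ [])
      ≡⟨ cong₂ _+_ v′ (valFrom-zeros-true (suc ℓ) o) ⟩
    m + T (3 + (suc ℓ + o))                           ≡⟨ cong (λ i → m + T (3 + i)) eq ⟩
    m + T (3 + n)                                     ≡⟨ +-comm m _ ⟩
    T (3 + n) + m                                     ∎)
    where
    admissible : No111 (u ++ true ∷ replicate o false ++ true ∷ [])
    admissible = No111-raise u o (No111-top u k (subst No111 e h))
      (λ o≡0 → not-11 (trans (sym (+-identityʳ (suc ℓ))) (subst (λ i → suc ℓ + i ≡ n) o≡0 eq)))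

-- Counting the numbers that end in 1

¬EndsIn1-0 : ¬ EndsIn1 0
¬EndsIn1-0 (ds , _ , v) = 1+n≢0 v

EndsIn1-1 : EndsIn1 1
EndsIn1-1 = [] , tt , refl

¬EndsIn1-T : ∀ n → 1 ≤ n → ¬ EndsIn1 (T (3 + n))
¬EndsIn1-T n 1≤n h = ¬EndsIn1-0
  (EndsIn1-drop-top 1≤n (1≤width n) (subst EndsIn1 (sym (+-identityʳ (T (3 + n)))) h))

endsIn1?-add-top : ∀ {n m} → 1 ≤ n → m < width n → Dec (EndsIn1 m) → Dec (EndsIn1 (T (3 + n) + m))
endsIn1?-add-top 1≤n m<w = map′ (EndsIn1-add-top 1≤n m<w) (EndsIn1-drop-top 1≤n m<w)

top-split : ∀ n m → m < T (4 + n) → T (3 + n) ≤ m → Σ ℕ λ m′ → m′ < width n × T (3 + n) + m′ ≡ m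
top-split n m m<T T≤m with m≤n⇒∃[o]m+o≡n T≤m
... | m′ , refl = m′ , +-cancelˡ-< (T (3 + n)) _ _ (subst (T (3 + n) + m′ <_) (T[4+n]≡T[3+n]+width n) m<T) , refl

endsIn1?-next : ∀ n → (∀ m → m < T (4 + n) → Dec (EndsIn1 m)) → ∀ m → m < T (5 + n) → Dec (EndsIn1 m)
endsIn1?-next n below? m m<T with m <? T (4 + n)
... | yes m<T′ = below? m m<T′
... | no m≮T′ with top-split (suc n) m m<T (≮⇒≥ m≮T′)
...   | m′ , m′<w , eq = subst (Dec ∘ EndsIn1) eq (endsIn1?-add-top {suc n} (s≤s z≤n) m′<w
          (below? m′ (<-≤-trans m′<w (width≤T[3+n] (suc n)))))

endsIn1?-below : ∀ n m → m < T (3 + n) → Dec (EndsIn1 m)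
endsIn1?-below zero zero _ = no ¬EndsIn1-0
endsIn1?-below zero (suc m) (s≤s ())
endsIn1?-below (suc zero) zero _ = no ¬EndsIn1-0
endsIn1?-below (suc zero) (suc zero) _ = yes EndsIn1-1
endsIn1?-below (suc zero) (suc (suc m)) (s≤s (s≤s ()))
endsIn1?-below (suc (suc n)) = endsIn1?-next n (endsIn1?-below (suc n))

endsIn1? : ∀ N → Dec (EndsIn1 N)
endsIn1? N = endsIn1?-below N N (n<T[3+n] N)

𝟙 : ∀ {P : Set} → Dec P → ℕ
𝟙 (yes _) = 1
𝟙 (no _) = 0

𝟙-cong : ∀ {P Q : Set} → (P → Q) → (Q → P) → (p : Dec P) (q : Dec Q) → 𝟙 p ≡ 𝟙 q
𝟙-cong _ _ (yes _) (yes _) = refl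
𝟙-cong P→Q _ (yes p) (no ¬q) = ⊥-elim (¬q (P→Q p))
𝟙-cong _ Q→P (no ¬p) (yes q) = ⊥-elim (¬p (Q→P q))
𝟙-cong _ _ (no _) (no _) = refl

count : ℕ → ℕ
count zero = 0
count (suc N) = count N + 𝟙 (endsIn1? (suc N))

count≤id : ∀ N → count N ≤ N
count≤id zero = z≤n
count≤id (suc N) with endsIn1? (suc N)
... | yes _ = subst (_≤ suc N) (+-comm 1 (count N)) (s≤s (count≤id N))
... | no _ = subst (_≤ suc N) (sym (+-identityʳ (count N))) (m≤n⇒m≤1+n (count≤id N))

count-pred : ∀ N → ¬ EndsIn1 N → count (pred N) ≡ count N
count-pred zero _ = refl
count-pred (suc N) ¬e with endsIn1? (suc N)
... | yes e = ⊥-elim (¬e e)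
... | no _ = sym (+-identityʳ (count N))

count-T+ : ∀ {n} → 1 ≤ n → ∀ m → m < width n → count (T (3 + n) + m) ≡ count (T (3 + n)) + count m
count-T+ {n} 1≤n zero _ = trans (cong count (+-identityʳ (T (3 + n)))) (sym (+-identityʳ _))
count-T+ {n} 1≤n (suc m) m<w = begin-equality
  count (T (3 + n) + suc m)                                ≡⟨ cong count (+-suc (T (3 + n)) m) ⟩
  count (T (3 + n) + m) + 𝟙 (endsIn1? (suc (T (3 + n) + m)))
    ≡⟨ cong₂ _+_ (count-T+ 1≤n m (<-trans (n<1+n m) m<w))
         (𝟙-cong (λ e → EndsIn1-drop-top {n} 1≤n m<w (subst EndsIn1 (sym (+-suc _ m)) e))
                 (λ e → subst EndsIn1 (+-suc _ m) (EndsIn1-add-top {n} 1≤n m<w e)) _ _) ⟩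
  count (T (3 + n)) + count m + 𝟙 (endsIn1? (suc m))      ≡⟨ +-assoc (count (T (3 + n))) _ _ ⟩
  count (T (3 + n)) + count (suc m)                        ∎

count-T-rec : ∀ k → count (T (7 + k)) ≡ count (T (6 + k)) + count (T (5 + k)) + count (T (4 + k))
count-T-rec k with m≤n⇒∃[o]m+o≡n (1≤T[2+n] (2 + k))
... | t , 1+t≡T = begin-equality
  count (T (7 + k))                               ≡⟨ count-pred _ (¬EndsIn1-T (4 + k) (s≤s z≤n)) ⟨
  count (pred (T (7 + k)))                        ≡⟨ cong count pred-T ⟩
  count (T (6 + k) + (T (5 + k) + t))             ≡⟨ count-T+ {3 + k} (s≤s z≤n) _ (+-monoʳ-< (T (5 + k)) t<T) ⟩
  count (T (6 + k)) + count (T (5 + k) + t)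
    ≡⟨ cong (_+_ (count (T (6 + k)))) (count-T+ {2 + k} (s≤s z≤n) t (<-≤-trans t<T (m≤m+n _ _))) ⟩
  count (T (6 + k)) + (count (T (5 + k)) + count t) ≡⟨ +-assoc (count (T (6 + k))) _ _ ⟨
  count (T (6 + k)) + count (T (5 + k)) + count t
    ≡⟨ cong (_+_ (count (T (6 + k)) + count (T (5 + k)))) count-t ⟩
  count (T (6 + k)) + count (T (5 + k)) + count (T (4 + k)) ∎
  where
  t<T : t < T (4 + k)
  t<T = subst (t <_) 1+t≡T ≤-refl
  pred-T : pred (T (7 + k)) ≡ T (6 + k) + (T (5 + k) + t)
  pred-T = begin-equality
    pred (T (6 + k) + T (5 + k) + T (4 + k)) ≡⟨ cong (λ x → pred (T (6 + k) + T (5 + k) + x)) 1+t≡T ⟨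
    pred (T (6 + k) + T (5 + k) + suc t)     ≡⟨ cong pred (+-suc (T (6 + k) + T (5 + k)) t) ⟩
    T (6 + k) + T (5 + k) + t                ≡⟨ +-assoc (T (6 + k)) _ _ ⟩
    T (6 + k) + (T (5 + k) + t)              ∎
  count-t : count t ≡ count (T (4 + k))
  count-t = trans (cong (count ∘ pred) 1+t≡T) (count-pred _ (¬EndsIn1-T (1 + k) (s≤s z≤n)))

count-T : ∀ k → count (T (4 + k)) ≡ width k
count-T 0 = refl
count-T 1 = refl
count-T 2 = refl
count-T (suc (suc (suc k))) = begin-equality
  count (T (7 + k))                                      ≡⟨ count-T-rec k ⟩
  count (T (6 + k)) + count (T (5 + k)) + count (T (4 + k))
    ≡⟨ cong₂ _+_ (cong₂ _+_ (count-T (suc (suc k))) (count-T (suc k))) (count-T k) ⟩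
  width (2 + k) + width (1 + k) + width k                ≡⟨ sum (T (4 + k)) (T (3 + k)) (T (2 + k)) (T (1 + k)) ⟩
  width (3 + k)                                          ∎
  where
  sum : ∀ a b c d → (a + b) + (b + c) + (c + d) ≡ (a + b + c) + (b + c + d)
  sum = solve-∀

T[3+n]≡count+T[2+n] : ∀ n → 1 ≤ n → T (3 + n) ≡ count (T (3 + n)) + T (2 + n)
T[3+n]≡count+T[2+n] (suc k) _ = begin-equality
  T (4 + k)                              ≡⟨ T[4+n]≡T[3+n]+width k ⟩
  T (3 + k) + width k                    ≡⟨ +-comm (T (3 + k)) _ ⟩
  width k + T (3 + k)                    ≡⟨ cong (_+ T (3 + k)) (count-T k) ⟨
  count (T (4 + k)) + T (3 + k)          ∎

EndsIn1⇒0< : ∀ {j} → EndsIn1 j → 0 < j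
EndsIn1⇒0< {zero} e = ⊥-elim (¬EndsIn1-0 e)
EndsIn1⇒0< {suc j} _ = s≤s z≤n

greedy : ∀ {n₀} N → T (3 + n₀) ≤ N → Σ ℕ λ n → n₀ ≤ n × Σ ℕ λ m → m < width n × T (3 + n) + m ≡ N
greedy {n₀} N T≤N with bracket N (≤-trans (1≤T[2+n] (suc n₀)) T≤N)
... | n , lo , hi = n , n₀≤n , top-split n N hi lo
  where
  n₀≤n : n₀ ≤ n
  n₀≤n with n₀ ≤? n
  ... | yes p = p
  ... | no n₀≰n = ⊥-elim (<⇒≱ hi (≤-trans (T-mono-≤ (+-monoʳ-≤ 3 (≰⇒> n₀≰n))) T≤N))

AdditiveFrom : ℕ → (ℕ → ℕ) → Set
AdditiveFrom n₀ f = ∀ {n} → n₀ ≤ n → ∀ m → m < width n → f (T (3 + n) + m) ≡ f (T (3 + n)) + f m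

-- Splitting off top digits greedily, an inequality between additive
-- functions at the numbers T (3 + n) propagates to every N, up to the error
-- the initial segment below T (3 + n₀) can cause.
greedy-bound : ∀ f g n₀ K → AdditiveFrom n₀ f → AdditiveFrom n₀ g →
  (∀ N → N < T (3 + n₀) → f N ≤ K) → (∀ n → n₀ ≤ n → f (T (3 + n)) ≤ g (T (3 + n))) →
  ∀ N → f N ≤ g N + K
greedy-bound f g n₀ K f-add g-add f-small f≤g = <-rec _ step
  where
  step : ∀ N → (∀ {m} → m < N → f m ≤ g m + K) → f N ≤ g N + K
  step N rec with N <? T (3 + n₀)
  ... | yes N<T = ≤-trans (f-small N N<T) (m≤n+m K (g N))
  ... | no N≮T with greedy {n₀} N (≮⇒≥ N≮T)
  ...   | n , n₀≤n , m , m<w , refl = begin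
          f (T (3 + n) + m)                 ≡⟨ f-add n₀≤n m m<w ⟩
          f (T (3 + n)) + f m               ≤⟨ +-mono-≤ (f≤g n n₀≤n) (rec (m<n+m m (1≤T[2+n] (suc n)))) ⟩
          g (T (3 + n)) + (g m + K)         ≡⟨ +-assoc (g (T (3 + n))) (g m) K ⟨
          g (T (3 + n)) + g m + K           ≡⟨ cong (_+ K) (g-add n₀≤n m m<w) ⟨
          g (T (3 + n) + m) + K             ∎

scaled-count-additive : ∀ x → AdditiveFrom 1 (λ N → x * count N)
scaled-count-additive x {n} 1≤n m m<w =
  trans (cong (x *_) (count-T+ 1≤n m m<w)) (*-distribˡ-+ x (count (T (3 + n))) (count m))

scaled-id-additive : ∀ {n₀} y → AdditiveFrom n₀ (y *_)
scaled-id-additive y {n} _ m _ = *-distribˡ-+ y (T (3 + n)) m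

count-upper : ∀ x y n₀ → 1 ≤ n₀ → (∀ n → n₀ ≤ n → x * count (T (3 + n)) ≤ y * T (3 + n)) →
  ∀ N → x * count N ≤ y * N + x * T (3 + n₀)
count-upper x y n₀ 1≤n₀ =
  greedy-bound (λ N → x * count N) (y *_) n₀ (x * T (3 + n₀))
    (λ n₀≤n → scaled-count-additive x (≤-trans 1≤n₀ n₀≤n)) (scaled-id-additive y)
    (λ N N<T → *-monoʳ-≤ x (≤-trans (count≤id N) (<⇒≤ N<T)))

count-lower : ∀ x y n₀ → 1 ≤ n₀ → (∀ n → n₀ ≤ n → y * T (3 + n) ≤ x * count (T (3 + n))) →
  ∀ N → y * N ≤ x * count N + y * T (3 + n₀)
count-lower x y n₀ 1≤n₀ =
  greedy-bound (y *_) (λ N → x * count N) n₀ (y * T (3 + n₀))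
    (scaled-id-additive y) (λ n₀≤n → scaled-count-additive x (≤-trans 1≤n₀ n₀≤n))
    (λ N N<T → *-monoʳ-≤ y (<⇒≤ N<T))

count-flat : ∀ {a c} → a ≤′ c → (∀ j → a < j → j ≤ c → ¬ EndsIn1 j) → count c ≡ count a
count-flat ≤′-refl _ = refl
count-flat {a} {suc c} (≤′-step a≤c) none with endsIn1? (suc c)
... | yes e = ⊥-elim (none (suc c) (s≤s (≤′⇒≤ a≤c)) ≤-refl e)
... | no _ = trans (+-identityʳ _) (count-flat a≤c (λ j a<j j≤c → none j a<j (m≤n⇒m≤1+n j≤c)))

count-next : ∀ a b → a < b → (∀ j → a < j → j < b → ¬ EndsIn1 j) → EndsIn1 b → count b ≡ suc (count a)
count-next a (suc c) (s≤s a≤c) none e with endsIn1? (suc c)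
... | no ¬e = ⊥-elim (¬e e)
... | yes _ = trans (+-comm (count c) 1) (cong suc (count-flat (≤⇒≤′ a≤c) (λ j a<j j≤c → none j a<j (s≤s j≤c))))

-- Ratios of consecutive Tribonacci numbers

Eventually : (ℕ → Set) → Set
Eventually P = Σ ℕ λ R → ∀ n → R ≤ n → P n

RatioAtLeast RatioAtMost : ℕ → ℕ → ℕ → Set
RatioAtLeast a b n = a * T n ≤ b * T (suc n)
RatioAtMost a b n = b * T (suc n) ≤ a * T n

RatioAtLeast-weaken : ∀ {a b a′ b′} n → 1 ≤ b → a′ * b ≤ a * b′ → RatioAtLeast a b n → RatioAtLeast a′ b′ n
RatioAtLeast-weaken {a} {b} {a′} {b′} n 1≤b le h = *-cancelˡ-≤ b {{>-nonZero 1≤b}} (begin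
  b * (a′ * T n)       ≡⟨ swap b a′ (T n) ⟩
  a′ * b * T n         ≤⟨ *-monoˡ-≤ (T n) le ⟩
  a * b′ * T n         ≡⟨ swap b′ a (T n) ⟨
  b′ * (a * T n)       ≤⟨ *-monoʳ-≤ b′ h ⟩
  b′ * (b * T (suc n)) ≡⟨ *-comm-middle b′ b (T (suc n)) ⟩
  b * (b′ * T (suc n)) ∎)
  where
  swap : ∀ x y z → x * (y * z) ≡ y * x * z
  swap = solve-∀
  *-comm-middle : ∀ x y z → x * (y * z) ≡ y * (x * z)
  *-comm-middle = solve-∀

RatioAtMost-weaken : ∀ {a b a′ b′} n → 1 ≤ b → a * b′ ≤ a′ * b → RatioAtMost a b n → RatioAtMost a′ b′ n
RatioAtMost-weaken {a} {b} {a′} {b′} n 1≤b le h = *-cancelˡ-≤ b {{>-nonZero 1≤b}} (begin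
  b * (b′ * T (suc n)) ≡⟨ *-comm-middle b b′ (T (suc n)) ⟩
  b′ * (b * T (suc n)) ≤⟨ *-monoʳ-≤ b′ h ⟩
  b′ * (a * T n)       ≡⟨ swap b′ a (T n) ⟩
  a * b′ * T n         ≤⟨ *-monoˡ-≤ (T n) le ⟩
  a′ * b * T n         ≡⟨ swap b a′ (T n) ⟨
  b * (a′ * T n)       ∎)
  where
  swap : ∀ x y z → x * (y * z) ≡ y * x * z
  swap = solve-∀
  *-comm-middle : ∀ x y z → x * (y * z) ≡ y * (x * z)
  *-comm-middle = solve-∀

-- T (3 + n) / T (2 + n) = 1 + x⁻¹ + (x x′)⁻¹ for the two previous ratios x, x′,
-- so bounds a / b on both of them give the bound φ a b / a² = 1 + b/a + (b/a)².
φ : ℕ → ℕ → ℕ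
φ a b = a * a + a * b + b * b

RatioAtMost-φ : ∀ a b n → RatioAtLeast a b n → RatioAtLeast a b (suc n) → RatioAtMost (φ a b) (a * a) (2 + n)
RatioAtMost-φ a b n p q = begin
  a * a * T (3 + n)                                           ≡⟨ expand a (T (2 + n)) (T (1 + n)) (T n) ⟩
  a * a * T (2 + n) + a * (a * T (1 + n)) + a * (a * T n)
    ≤⟨ +-mono-≤ (+-monoʳ-≤ (a * a * T (2 + n)) (*-monoʳ-≤ a q)) (*-monoʳ-≤ a p) ⟩
  a * a * T (2 + n) + a * (b * T (2 + n)) + a * (b * T (1 + n)) ≡⟨ regroup a b (T (2 + n)) (T (1 + n)) ⟩
  a * a * T (2 + n) + a * b * T (2 + n) + b * (a * T (1 + n))
    ≤⟨ +-monoʳ-≤ (a * a * T (2 + n) + a * b * T (2 + n)) (*-monoʳ-≤ b q) ⟩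
  a * a * T (2 + n) + a * b * T (2 + n) + b * (b * T (2 + n)) ≡⟨ collect a b (T (2 + n)) ⟩
  φ a b * T (2 + n)                                           ∎
  where
  expand : ∀ a x y z → a * a * (x + y + z) ≡ a * a * x + a * (a * y) + a * (a * z)
  expand = solve-∀
  regroup : ∀ a b x y → a * a * x + a * (b * x) + a * (b * y) ≡ a * a * x + a * b * x + b * (a * y)
  regroup = solve-∀
  collect : ∀ a b x → a * a * x + a * b * x + b * (b * x) ≡ (a * a + a * b + b * b) * x
  collect = solve-∀

RatioAtLeast-φ : ∀ a b n → RatioAtMost a b n → RatioAtMost a b (suc n) → RatioAtLeast (φ a b) (a * a) (2 + n)
RatioAtLeast-φ a b n p q = begin
  φ a b * T (2 + n)                                           ≡⟨ collect a b (T (2 + n)) ⟨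
  a * a * T (2 + n) + a * b * T (2 + n) + b * (b * T (2 + n))
    ≤⟨ +-monoʳ-≤ (a * a * T (2 + n) + a * b * T (2 + n)) (*-monoʳ-≤ b q) ⟩
  a * a * T (2 + n) + a * b * T (2 + n) + b * (a * T (1 + n)) ≡⟨ regroup a b (T (2 + n)) (T (1 + n)) ⟨
  a * a * T (2 + n) + a * (b * T (2 + n)) + a * (b * T (1 + n))
    ≤⟨ +-mono-≤ (+-monoʳ-≤ (a * a * T (2 + n)) (*-monoʳ-≤ a q)) (*-monoʳ-≤ a p) ⟩
  a * a * T (2 + n) + a * (a * T (1 + n)) + a * (a * T n)     ≡⟨ expand a (T (2 + n)) (T (1 + n)) (T n) ⟨
  a * a * T (3 + n)                                           ∎
  where
  expand : ∀ a x y z → a * a * (x + y + z) ≡ a * a * x + a * (a * y) + a * (a * z)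
  expand = solve-∀
  regroup : ∀ a b x y → a * a * x + a * (b * x) + a * (b * y) ≡ a * a * x + a * b * x + b * (a * y)
  regroup = solve-∀
  collect : ∀ a b x → a * a * x + a * b * x + b * (b * x) ≡ (a * a + a * b + b * b) * x
  collect = solve-∀

≤-literal : ∀ m n → {True (m ≤ᵇ n)} → m ≤ n
≤-literal m n {p} = ≤ᵇ⇒≤ m n p

-- φ maps [9/5, 19/10] into itself: 651/361 ≥ 9/5 and 151/81 ≤ 19/10.
ratio-initial-bounds : ∀ k → let n = 6 + k in
  (RatioAtLeast 9 5 n × RatioAtMost 19 10 n) × (RatioAtLeast 9 5 (suc n) × RatioAtMost 19 10 (suc n))
ratio-initial-bounds zero = (≤-literal 63 65 , ≤-literal 130 133) , (≤-literal 117 120 , ≤-literal 240 247)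
ratio-initial-bounds (suc k) with ratio-initial-bounds k
... | (l₀ , u₀) , (l₁ , u₁) = (l₁ , u₁) ,
  (RatioAtLeast-weaken {651} {361} {9} {5} (8 + k) (≤-literal 1 361) (≤-literal 3249 3255) (RatioAtLeast-φ 19 10 (6 + k) u₀ u₁) ,
   RatioAtMost-weaken {151} {81} {19} {10} (8 + k) (≤-literal 1 81) (≤-literal 1510 1539) (RatioAtMost-φ 9 5 (6 + k) l₀ l₁))

loN loD hiN hiD : ℕ → ℕ
loN zero = 9
loN (suc k) = φ (hiN k) (hiD k)
loD zero = 5
loD (suc k) = hiN k * hiN k
hiN zero = 19
hiN (suc k) = φ (loN k) (loD k)
hiD zero = 10
hiD (suc k) = loN k * loN k

ratio-bounds : ∀ k n → 6 + 2 * k ≤ n → RatioAtLeast (loN k) (loD k) n × RatioAtMost (hiN k) (hiD k) n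
ratio-bounds zero n 6≤n with m≤n⇒∃[o]m+o≡n 6≤n
... | j , refl = proj₁ (ratio-initial-bounds j)
ratio-bounds (suc k) n le with m≤n⇒∃[o]m+o≡n le
... | j , refl = subst (λ n → RatioAtLeast (loN (suc k)) (loD (suc k)) n × RatioAtMost (hiN (suc k)) (hiD (suc k)) n)
                   (shift k j)
                   (RatioAtLeast-φ (hiN k) (hiD k) m (proj₂ (ratio-bounds k m ≤m)) (proj₂ (ratio-bounds k (suc m) ≤1+m)) ,
                    RatioAtMost-φ (loN k) (loD k) m (proj₁ (ratio-bounds k m ≤m)) (proj₁ (ratio-bounds k (suc m) ≤1+m)))
  where
  m = 6 + 2 * k + j
  ≤m : 6 + 2 * k ≤ m
  ≤m = m≤m+n _ j
  ≤1+m : 6 + 2 * k ≤ suc m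
  ≤1+m = m≤n⇒m≤1+n ≤m
  shift : ∀ k j → 2 + (6 + 2 * k + j) ≡ 6 + 2 * suc k + j
  shift = solve-∀

cube : ℕ → ℕ
cube a = a * a * a

-- For b > 0, a / b < α exactly when cube a < cubicRest a b, as α³ = α² + α + 1.
cubicRest : ℕ → ℕ → ℕ
cubicRest a b = a * a * b + a * b * b + b * b * b

BelowBy AboveBy : ℕ → ℕ → ℕ → Set
BelowBy a b D = cubicRest a b ≡ cube a + D
AboveBy a b D = cube a ≡ cubicRest a b + D

flipFactor : ℕ → ℕ → ℕ
flipFactor a b = 2 * (a * a * a) + 2 * (a * a * b) + 2 * (a * b * b) + b * b * b

cube-φ+ : ∀ a b → cube (φ a b) + cube a * flipFactor a b ≡ cubicRest (φ a b) (a * a) + cubicRest a b * flipFactor a b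
cube-φ+ = identity
  where
  identity : ∀ a b → let x = a * a + a * b + b * b ; y = a * a in
    x * x * x + a * a * a * (2 * (a * a * a) + 2 * (a * a * b) + 2 * (a * b * b) + b * b * b)
    ≡ x * x * y + x * y * y + y * y * y
      + (a * a * b + a * b * b + b * b * b) * (2 * (a * a * a) + 2 * (a * a * b) + 2 * (a * b * b) + b * b * b)
  identity = solve-∀

BelowBy-φ : ∀ a b D → BelowBy a b D → AboveBy (φ a b) (a * a) (D * flipFactor a b)
BelowBy-φ a b D h = +-cancelʳ-≡ (cube a * flipFactor a b) _ _ (begin-equality
  cube (φ a b) + cube a * flipFactor a b                        ≡⟨ cube-φ+ a b ⟩
  cubicRest (φ a b) (a * a) + cubicRest a b * flipFactor a b
    ≡⟨ cong (λ z → cubicRest (φ a b) (a * a) + z * flipFactor a b) h ⟩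
  cubicRest (φ a b) (a * a) + (cube a + D) * flipFactor a b     ≡⟨ distrib _ (cube a) D (flipFactor a b) ⟩
  cubicRest (φ a b) (a * a) + D * flipFactor a b + cube a * flipFactor a b ∎)
  where
  distrib : ∀ x y z r → x + (y + z) * r ≡ x + z * r + y * r
  distrib = solve-∀

AboveBy-φ : ∀ a b D → AboveBy a b D → BelowBy (φ a b) (a * a) (D * flipFactor a b)
AboveBy-φ a b D h = +-cancelʳ-≡ (cubicRest a b * flipFactor a b) _ _ (begin-equality
  cubicRest (φ a b) (a * a) + cubicRest a b * flipFactor a b    ≡⟨ cube-φ+ a b ⟨
  cube (φ a b) + cube a * flipFactor a b                        ≡⟨ cong (λ z → cube (φ a b) + z * flipFactor a b) h ⟩
  cube (φ a b) + (cubicRest a b + D) * flipFactor a b           ≡⟨ distrib _ (cubicRest a b) D (flipFactor a b) ⟩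
  cube (φ a b) + D * flipFactor a b + cubicRest a b * flipFactor a b ∎)
  where
  distrib : ∀ x y z r → x + (y + z) * r ≡ x + z * r + y * r
  distrib = solve-∀

InWindow : ℕ → ℕ → Set
InWindow a b = 1 ≤ b × 9 * b ≤ 5 * a × 10 * a ≤ 19 * b

InWindow-φ-lower : ∀ a b → 10 * a ≤ 19 * b → 9 * (a * a) ≤ 5 * φ a b
InWindow-φ-lower a b p = *-cancelˡ-≤ 361 (begin
  361 * (9 * (a * a))                 ≡⟨ e₁ a ⟩
  3249 * (a * a)                      ≤⟨ *-monoˡ-≤ (a * a) (≤-literal 3249 3255) ⟩
  3255 * (a * a)                      ≡⟨ e₂ a ⟩
  1805 * (a * a) + 5 * (19 * a) * (10 * a) + 5 * (10 * a) * (10 * a)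
    ≤⟨ +-mono-≤ (+-monoʳ-≤ (1805 * (a * a)) (*-monoʳ-≤ (5 * (19 * a)) p)) (*-mono-≤ (*-monoʳ-≤ 5 p) p) ⟩
  1805 * (a * a) + 5 * (19 * a) * (19 * b) + 5 * (19 * b) * (19 * b) ≡⟨ e₃ a b ⟩
  361 * (5 * φ a b)                   ∎)
  where
  e₁ : ∀ a → 361 * (9 * (a * a)) ≡ 3249 * (a * a)
  e₁ = solve-∀
  e₂ : ∀ a → 3255 * (a * a) ≡ 1805 * (a * a) + 5 * (19 * a) * (10 * a) + 5 * (10 * a) * (10 * a)
  e₂ = solve-∀
  e₃ : ∀ a b → 1805 * (a * a) + 5 * (19 * a) * (19 * b) + 5 * (19 * b) * (19 * b) ≡ 361 * (5 * (a * a + a * b + b * b))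
  e₃ = solve-∀

InWindow-φ-upper : ∀ a b → 9 * b ≤ 5 * a → 10 * φ a b ≤ 19 * (a * a)
InWindow-φ-upper a b p = *-cancelˡ-≤ 81 (begin
  81 * (10 * φ a b)                   ≡⟨ e₁ a b ⟩
  810 * (a * a) + 10 * (9 * a) * (9 * b) + 10 * (9 * b) * (9 * b)
    ≤⟨ +-mono-≤ (+-monoʳ-≤ (810 * (a * a)) (*-monoʳ-≤ (10 * (9 * a)) p)) (*-mono-≤ (*-monoʳ-≤ 10 p) p) ⟩
  810 * (a * a) + 10 * (9 * a) * (5 * a) + 10 * (5 * a) * (5 * a) ≡⟨ e₂ a ⟩
  1510 * (a * a)                      ≤⟨ *-monoˡ-≤ (a * a) (≤-literal 1510 1539) ⟩
  1539 * (a * a)                      ≡⟨ e₃ a ⟩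
  81 * (19 * (a * a))                 ∎)
  where
  e₁ : ∀ a b → 81 * (10 * (a * a + a * b + b * b)) ≡ 810 * (a * a) + 10 * (9 * a) * (9 * b) + 10 * (9 * b) * (9 * b)
  e₁ = solve-∀
  e₂ : ∀ a → 810 * (a * a) + 10 * (9 * a) * (5 * a) + 10 * (5 * a) * (5 * a) ≡ 1510 * (a * a)
  e₂ = solve-∀
  e₃ : ∀ a → 1539 * (a * a) ≡ 81 * (19 * (a * a))
  e₃ = solve-∀

InWindow⇒b≤a : ∀ {a b} → InWindow a b → b ≤ a
InWindow⇒b≤a {a} (_ , p , _) = *-cancelˡ-≤ 9 (≤-trans p (*-monoˡ-≤ a (≤-literal 5 9)))

InWindow-φ : ∀ {a b} → InWindow a b → InWindow (φ a b) (a * a)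
InWindow-φ {a} {b} w@(1≤b , p , q) =
  *-mono-≤ 1≤a 1≤a , InWindow-φ-lower a b q , InWindow-φ-upper a b p
  where
  1≤a : 1 ≤ a
  1≤a = ≤-trans 1≤b (InWindow⇒b≤a w)

-- 729 and 2843 come from bounding flipFactor a b by a³ with b ≤ 5a/9.
flipFactor-bound : ∀ a b → 9 * b ≤ 5 * a → 729 * flipFactor a b ≤ 2843 * cube a
flipFactor-bound a b p = begin
    729 * flipFactor a b     ≡⟨ e′ 9 a b ⟩
    2 * (9 * 9 * 9) * cube a + 2 * (9 * 9 * (a * a)) * (9 * b) + 2 * (9 * a) * ((9 * b) * (9 * b)) + (9 * b) * (9 * b) * (9 * b)
      ≤⟨ +-mono-≤ (+-mono-≤ (+-monoʳ-≤ (2 * (9 * 9 * 9) * cube a) (*-monoʳ-≤ (2 * (9 * 9 * (a * a))) p))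
           (*-monoʳ-≤ (2 * (9 * a)) (*-mono-≤ p p))) (*-mono-≤ (*-mono-≤ p p) p) ⟩
    2 * (9 * 9 * 9) * cube a + 2 * (9 * 9 * (a * a)) * (5 * a) + 2 * (9 * a) * ((5 * a) * (5 * a)) + (5 * a) * (5 * a) * (5 * a)
      ≡⟨ e″ 9 5 a ⟩
    2843 * cube a            ∎
    where
    e′ : ∀ k a b → k * k * k * (2 * (a * a * a) + 2 * (a * a * b) + 2 * (a * b * b) + b * b * b) ≡
      2 * (k * k * k) * (a * a * a) + 2 * (k * k * (a * a)) * (k * b) + 2 * (k * a) * ((k * b) * (k * b)) + (k * b) * (k * b) * (k * b)
    e′ = solve-∀
    e″ : ∀ k m a → 2 * (k * k * k) * (a * a * a) + 2 * (k * k * (a * a)) * (m * a) + 2 * (k * a) * ((m * a) * (m * a)) + (m * a) * (m * a) * (m * a)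
      ≡ (2 * (k * k * k) + 2 * (k * k) * m + 2 * k * (m * m) + m * m * m) * (a * a * a)
    e″ = solve-∀

cube-mono : ∀ k l a b → k * b ≤ l * a → (k * k * k) * cube b ≤ (l * l * l) * cube a
cube-mono k l a b p = begin
  (k * k * k) * cube b        ≡⟨ e k b ⟩
  (k * b) * (k * b) * (k * b) ≤⟨ *-mono-≤ (*-mono-≤ p p) p ⟩
  (l * a) * (l * a) * (l * a) ≡⟨ e l a ⟨
  (l * l * l) * cube a        ∎
  where
  e : ∀ k b → (k * k * k) * (b * b * b) ≡ (k * b) * (k * b) * (k * b)
  e = solve-∀

cube-* : ∀ a b → cube a * cube b ≡ cube (a * b)
cube-* = identity
  where
  identity : ∀ a b → (a * a * a) * (b * b * b) ≡ (a * b) * (a * b) * (a * b)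
  identity = solve-∀

flipFactor-contracts : ∀ a b → 9 * b ≤ 5 * a → 10 * (cube b * flipFactor a b) ≤ 7 * cube (a * a)
flipFactor-contracts a b p = *-cancelˡ-≤ (729 * 729) (begin
  (729 * 729) * (10 * (cube b * flipFactor a b))   ≡⟨ e 729 10 (cube b) (flipFactor a b) ⟩
  10 * ((729 * cube b) * (729 * flipFactor a b))   ≤⟨ *-monoʳ-≤ 10 (*-mono-≤ (cube-mono 9 5 a b p) (flipFactor-bound a b p)) ⟩
  10 * ((125 * cube a) * (2843 * cube a))         ≡⟨ e′ 10 125 2843 (cube a) ⟩
  (10 * 125 * 2843) * (cube a * cube a)           ≤⟨ *-monoˡ-≤ (cube a * cube a) (≤-literal (10 * 125 * 2843) (729 * 729 * 7)) ⟩
  (729 * 729 * 7) * (cube a * cube a)             ≡⟨ cong ((729 * 729 * 7) *_) (cube-* a a) ⟩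
  (729 * 729 * 7) * cube (a * a)                  ≡⟨ *-assoc (729 * 729) 7 (cube (a * a)) ⟩
  (729 * 729) * (7 * cube (a * a))                ∎)
  where
  e : ∀ k t c r → (k * k) * (t * (c * r)) ≡ t * ((k * c) * (k * r))
  e = solve-∀
  e′ : ∀ t u v x → t * ((u * x) * (v * x)) ≡ (t * u * v) * (x * x)
  e′ = solve-∀

1≤cube : ∀ {b} → 1 ≤ b → 1 ≤ cube b
1≤cube p = *-mono-≤ (*-mono-≤ p p) p

Decays : ℕ → (ℕ → ℕ → ℕ → Set) → ℕ → ℕ → Set
Decays k Defect a b = Σ ℕ λ D → Defect a b D × 2 * 10 ^ k * D ≤ 7 ^ k * cube b

decay-step : ∀ a b D k → 1 ≤ b → 9 * b ≤ 5 * a → 2 * 10 ^ k * D ≤ 7 ^ k * cube b →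
  2 * 10 ^ suc k * (D * flipFactor a b) ≤ 7 ^ suc k * cube (a * a)
decay-step a b D k 1≤b p h = *-cancelˡ-≤ (cube b) {{>-nonZero (1≤cube 1≤b)}} (begin
  cube b * (2 * 10 ^ suc k * (D * flipFactor a b))    ≡⟨ e₁ (cube b) (10 ^ k) D (flipFactor a b) ⟩
  (2 * 10 ^ k * D) * (10 * (cube b * flipFactor a b)) ≤⟨ *-mono-≤ h (flipFactor-contracts a b p) ⟩
  (7 ^ k * cube b) * (7 * cube (a * a))               ≡⟨ e₂ (cube b) (7 ^ k) (cube (a * a)) ⟩
  cube b * (7 ^ suc k * cube (a * a))                 ∎)
  where
  e₁ : ∀ c x D r → c * (2 * (10 * x) * (D * r)) ≡ (2 * x * D) * (10 * (c * r))
  e₁ = solve-∀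
  e₂ : ∀ c y z → (y * c) * (7 * z) ≡ c * ((7 * y) * z)
  e₂ = solve-∀

bounds-converge : ∀ k → (InWindow (loN k) (loD k) × Decays k BelowBy (loN k) (loD k))
                      × (InWindow (hiN k) (hiD k) × Decays k AboveBy (hiN k) (hiD k))
bounds-converge zero = ((≤-literal 1 5 , ≤-literal 45 45 , ≤-literal 90 95) , 26 , refl , ≤-literal 52 125) ,
                       ((≤-literal 1 10 , ≤-literal 90 95 , ≤-literal 190 190) , 349 , refl , ≤-literal 698 1000)
bounds-converge (suc k) with bounds-converge k
... | (wL@(1≤bL , pL , _) , DL , bL , dL) , (wU@(1≤bU , pU , _) , DU , aU , dU) =
  (InWindow-φ {hiN k} wU , DU * flipFactor (hiN k) (hiD k) , AboveBy-φ (hiN k) (hiD k) DU aU ,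
     decay-step (hiN k) (hiD k) DU k 1≤bU pU dU) ,
  (InWindow-φ {loN k} wL , DL * flipFactor (loN k) (loD k) , BelowBy-φ (loN k) (loD k) DL bL ,
     decay-step (loN k) (loD k) DL k 1≤bL pL dL)

7^k[7+3k]≤7*10^k : ∀ k → 7 ^ k * (7 + 3 * k) ≤ 7 * 10 ^ k
7^k[7+3k]≤7*10^k zero = ≤-refl
7^k[7+3k]≤7*10^k (suc k) = begin
  7 * 7 ^ k * (7 + 3 * suc k)       ≡⟨ e (7 ^ k) k ⟩
  7 * (7 ^ k * (7 + 3 * k)) + 21 * 7 ^ k
    ≤⟨ +-mono-≤ (*-monoʳ-≤ 7 (7^k[7+3k]≤7*10^k k)) (*-monoʳ-≤ 21 (^-monoˡ-≤ k (≤-literal 7 10))) ⟩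
  7 * (7 * 10 ^ k) + 21 * 10 ^ k    ≡⟨ e′ (10 ^ k) ⟩
  7 * (10 * 10 ^ k)                 ∎
  where
  e : ∀ x k → 7 * x * (7 + 3 * (1 + k)) ≡ 7 * (x * (7 + 3 * k)) + 21 * x
  e = solve-∀
  e′ : ∀ y → 7 * (7 * y) + 21 * y ≡ 7 * (10 * y)
  e′ = solve-∀

3*7^k*d³≤10^k : ∀ d → let k = 7 * cube d in 3 * (7 ^ k * cube d) ≤ 10 ^ k
3*7^k*d³≤10^k d = *-cancelˡ-≤ 7 (begin
  7 * (3 * (7 ^ k * cube d)) ≡⟨ e (7 ^ k) (cube d) ⟩
  7 ^ k * (3 * k)            ≤⟨ *-monoʳ-≤ (7 ^ k) (m≤n+m (3 * k) 7) ⟩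
  7 ^ k * (7 + 3 * k)        ≤⟨ 7^k[7+3k]≤7*10^k k ⟩
  7 * 10 ^ k                 ∎)
  where
  k = 7 * cube d
  e : ∀ x y → 7 * (3 * (x * y)) ≡ x * (3 * (7 * y))
  e = solve-∀

defect-small : ∀ b d D → 1 ≤ b → 1 ≤ d → let k = 7 * cube d in
  2 * 10 ^ k * D ≤ 7 ^ k * cube b → D * cube d < cube b
defect-small b d D 1≤b 1≤d h with D * cube d <? cube b
... | yes lt = lt
... | no ≮ = ⊥-elim (<-irrefl refl (begin-strict
    x                 <⟨ m<m+n x (≤-trans 1≤x (m≤m+n x x)) ⟩
    x + (x + x)       ≡⟨ cong (λ y → x + (x + y)) (+-identityʳ x) ⟨
    3 * x             ≤⟨ 3*7^k*d³≤10^k d ⟩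
    10 ^ k            ≤⟨ m≤m+n (10 ^ k) _ ⟩
    2 * 10 ^ k        ≤⟨ 2*10^k≤x ⟩
    x                 ∎))
  where
  k = 7 * cube d
  x = 7 ^ k * cube d
  1≤x : 1 ≤ x
  1≤x = *-mono-≤ (m^n>0 7 k) (1≤cube 1≤d)
  2*10^k≤x : 2 * 10 ^ k ≤ x
  2*10^k≤x = *-cancelˡ-≤ (cube b) {{>-nonZero (1≤cube 1≤b)}} (begin
    cube b * (2 * 10 ^ k)      ≤⟨ *-monoˡ-≤ (2 * 10 ^ k) (≮⇒≥ ≮) ⟩
    D * cube d * (2 * 10 ^ k)  ≡⟨ e D (cube d) (2 * 10 ^ k) ⟩
    (2 * 10 ^ k * D) * cube d  ≤⟨ *-monoˡ-≤ (cube d) h ⟩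
    7 ^ k * cube b * cube d    ≡⟨ e′ (7 ^ k) (cube b) (cube d) ⟩
    cube b * x                 ∎)
    where
    e : ∀ D c t → D * c * t ≡ t * D * c
    e = solve-∀
    e′ : ∀ y b c → y * b * c ≡ b * (y * c)
    e′ = solve-∀

-- x ↦ x³ − x² − x − 1 is increasing for x ≥ 1, here between a / b ≤ c / d
-- with denominators cleared.
cubicGap-mono : ∀ a b c d → b ≤ a → d ≤ c → a * d ≤ c * b →
  cube a * cube d + cubicRest c d * cube b ≤ cube c * cube b + cubicRest a b * cube d
cubicGap-mono a b c d b≤a d≤c ad≤cb with m≤n⇒∃[o]m+o≡n b≤a | m≤n⇒∃[o]m+o≡n d≤c
... | t , refl | s , refl = +-cancelʳ-≤ (c * b * Q) _ _ (begin
  cube a * cube d + cubicRest c d * cube b + c * b * Q ≡⟨ identity b d s t ⟩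
  cube c * cube b + cubicRest a b * cube d + a * d * Q ≤⟨ +-monoʳ-≤ _ (*-monoˡ-≤ Q ad≤cb) ⟩
  cube c * cube b + cubicRest a b * cube d + c * b * Q ∎)
  where
  Q = c * (b * b) * s + a * b * d * s + d * d * t * (a + b)
  identity : ∀ b d s t → let a = b + t ; c = d + s ; Q = c * (b * b) * s + a * b * d * s + d * d * t * (a + b) in
    (a * a * a) * (d * d * d) + (c * c * d + c * d * d + d * d * d) * (b * b * b) + c * b * Q
    ≡ (c * c * c) * (b * b * b) + (a * a * b + a * b * b + b * b * b) * (d * d * d) + a * d * Q
  identity = solve-∀

BelowBy-defect-mono : ∀ {a b c d D E} → BelowBy a b D → BelowBy c d E →
  b ≤ a → d ≤ c → a * d ≤ c * b → E * cube b ≤ D * cube d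
BelowBy-defect-mono {a} {b} {c} {d} {D} {E} ha hc b≤a d≤c ad≤cb = +-cancelˡ-≤ (cube a * cube d + cube c * cube b) _ _ (begin
  cube a * cube d + cube c * cube b + E * cube b     ≡⟨ e (cube a * cube d) (cube c) E (cube b) ⟩
  cube a * cube d + (cube c + E) * cube b            ≡⟨ cong (λ z → cube a * cube d + z * cube b) hc ⟨
  cube a * cube d + cubicRest c d * cube b           ≤⟨ cubicGap-mono a b c d b≤a d≤c ad≤cb ⟩
  cube c * cube b + cubicRest a b * cube d           ≡⟨ cong (λ z → cube c * cube b + z * cube d) ha ⟩
  cube c * cube b + (cube a + D) * cube d            ≡⟨ e′ (cube c * cube b) (cube a) D (cube d) ⟩
  cube a * cube d + cube c * cube b + D * cube d     ∎)
  where
  e : ∀ x y z w → x + y * w + z * w ≡ x + (y + z) * w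
  e = solve-∀
  e′ : ∀ x y z w → x + (y + z) * w ≡ y * w + x + z * w
  e′ = solve-∀

AboveBy-defect-mono : ∀ {a b c d D E} → AboveBy a b D → AboveBy c d E →
  b ≤ a → d ≤ c → c * b ≤ a * d → E * cube b ≤ D * cube d
AboveBy-defect-mono {a} {b} {c} {d} {D} {E} ha hc b≤a d≤c cb≤ad = +-cancelˡ-≤ (cubicRest c d * cube b + cubicRest a b * cube d) _ _ (begin
  cubicRest c d * cube b + cubicRest a b * cube d + E * cube b ≡⟨ e (cubicRest c d) (cubicRest a b * cube d) E (cube b) ⟩
  (cubicRest c d + E) * cube b + cubicRest a b * cube d        ≡⟨ cong (λ z → z * cube b + cubicRest a b * cube d) hc ⟨
  cube c * cube b + cubicRest a b * cube d                     ≤⟨ cubicGap-mono c d a b d≤c b≤a cb≤ad ⟩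
  cube a * cube d + cubicRest c d * cube b                     ≡⟨ cong (λ z → z * cube d + cubicRest c d * cube b) ha ⟩
  (cubicRest a b + D) * cube d + cubicRest c d * cube b        ≡⟨ e′ (cubicRest a b) D (cube d) (cubicRest c d * cube b) ⟩
  cubicRest c d * cube b + cubicRest a b * cube d + D * cube d ∎)
  where
  e : ∀ y x z w → y * w + x + z * w ≡ (y + z) * w + x
  e = solve-∀
  e′ : ∀ y z w x → (y + z) * w + x ≡ x + y * w + z * w
  e′ = solve-∀

<⇒≡+suc : ∀ {x y} → x < y → Σ ℕ λ E → y ≡ x + suc E
<⇒≡+suc {x} x<y with m≤n⇒∃[o]m+o≡n x<y
... | E , refl = E , sym (+-suc x E)

-- A bound a / b on the same side of α as c / d but with a smaller relative
-- defect lies beyond c / d.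
BelowBy-passes : ∀ {a b D} c d → InWindow a b → BelowBy a b D → D * cube d < cube b →
  cube c < cubicRest c d → c * b < a * d
BelowBy-passes {a} {b} {D} c d window below small c<α with <⇒≡+suc c<α
... | E , rest≡ with c * b <? a * d | c <? d
... | yes lt | _ = lt
... | no _ | yes c<d = begin-strict
  c * b   <⟨ *-monoˡ-< b {{>-nonZero (proj₁ window)}} c<d ⟩
  d * b   ≤⟨ *-monoʳ-≤ d (InWindow⇒b≤a {a} window) ⟩
  d * a   ≡⟨ *-comm d a ⟩
  a * d   ∎
... | no ≮ | no c≮d = ⊥-elim (<⇒≱ small (begin
  cube b              ≤⟨ m≤m+n (cube b) _ ⟩
  suc E * cube b      ≤⟨ BelowBy-defect-mono {a} {b} {c} {d} {D} {suc E} below rest≡ (InWindow⇒b≤a window) (≮⇒≥ c≮d) (≮⇒≥ ≮) ⟩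
  D * cube d          ∎))

AboveBy-passes : ∀ {a b D} c d → InWindow a b → AboveBy a b D → D * cube d < cube b →
  cubicRest c d < cube c → a * d < c * b
AboveBy-passes {a} {b} {D} c d window above small α<c with <⇒≡+suc α<c
... | E , cube≡ with a * d <? c * b
... | yes lt = lt
... | no ≮ = ⊥-elim (<⇒≱ small (begin
  cube b              ≤⟨ m≤m+n (cube b) _ ⟩
  suc E * cube b      ≤⟨ AboveBy-defect-mono {a} {b} {c} {d} {D} {suc E} above cube≡ (InWindow⇒b≤a window) d≤c (≮⇒≥ ≮) ⟩
  D * cube d          ∎))
  where
  d≤c : d ≤ c
  d≤c with c <? d
  ... | no c≮d = ≮⇒≥ c≮d
  ... | yes c<d = ⊥-elim (<⇒≱ α<c (begin
    c * c * c             ≤⟨ *-monoʳ-≤ (c * c) (<⇒≤ c<d) ⟩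
    c * c * d             ≤⟨ m≤m+n (c * c * d) _ ⟩
    c * c * d + c * d * d ≤⟨ m≤m+n _ _ ⟩
    cubicRest c d         ∎))

RatioAtLeast-eventually : ∀ c d → 1 ≤ d → cube c < cubicRest c d → Eventually (RatioAtLeast c d)
RatioAtLeast-eventually c d 1≤d c<α with bounds-converge (7 * cube d)
... | (window , D , below , decay) , _ = 6 + 2 * k , λ n le →
  RatioAtLeast-weaken {loN k} {loD k} {c} {d} n (proj₁ window)
    (<⇒≤ (BelowBy-passes {loN k} {loD k} {D} c d window below (defect-small _ d D (proj₁ window) 1≤d decay) c<α))
    (proj₁ (ratio-bounds k n le))
  where
  k = 7 * cube d

RatioAtMost-eventually : ∀ c d → 1 ≤ d → cubicRest c d < cube c → Eventually (RatioAtMost c d)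
RatioAtMost-eventually c d 1≤d α<c with bounds-converge (7 * cube d)
... | _ , (window , D , above , decay) = 6 + 2 * k , λ n le →
  RatioAtMost-weaken {hiN k} {hiD k} {c} {d} n (proj₁ window)
    (<⇒≤ (AboveBy-passes {hiN k} {hiD k} {D} c d window above (defect-small _ d D (proj₁ window) 1≤d decay) α<c))
    (proj₂ (ratio-bounds k n le))
  where
  k = 7 * cube d

-- Reading the rational cuts

-- Rational expressions in two variables, to read off the integer inequality
-- hidden in a rational one: on normalised rationals ↥ and ↧ are not
-- homomorphic, so the expression is evaluated in ℚᵘ, where they are.
data Expr : Set where
  var₁ var₂ one half : Expr
  _⊕_ _⊗_ _⊖_ : Expr → Expr → Expr

infixl 6 _⊕_ _⊖_
infixl 7 _⊗_

⟦_⟧ : Expr → ℚ → ℚ → ℚ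
⟦ var₁ ⟧ p a = p
⟦ var₂ ⟧ p a = a
⟦ one ⟧ p a = ℚ.1ℚ
⟦ half ⟧ p a = ℚ.½
⟦ x ⊕ y ⟧ p a = ⟦ x ⟧ p a ℚ.+ ⟦ y ⟧ p a
⟦ x ⊗ y ⟧ p a = ⟦ x ⟧ p a ℚ.* ⟦ y ⟧ p a
⟦ x ⊖ y ⟧ p a = ⟦ x ⟧ p a ℚ.- ⟦ y ⟧ p a

⟦_⟧ᵘ : Expr → ℚᵘ.ℚᵘ → ℚᵘ.ℚᵘ → ℚᵘ.ℚᵘ
⟦ var₁ ⟧ᵘ p a = p
⟦ var₂ ⟧ᵘ p a = a
⟦ one ⟧ᵘ p a = ℚᵘ.1ℚᵘ
⟦ half ⟧ᵘ p a = ℚᵘ.½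
⟦ x ⊕ y ⟧ᵘ p a = ⟦ x ⟧ᵘ p a ℚᵘ.+ ⟦ y ⟧ᵘ p a
⟦ x ⊗ y ⟧ᵘ p a = ⟦ x ⟧ᵘ p a ℚᵘ.* ⟦ y ⟧ᵘ p a
⟦ x ⊖ y ⟧ᵘ p a = ⟦ x ⟧ᵘ p a ℚᵘ.- ⟦ y ⟧ᵘ p a

toℚᵘ-⟦⟧ : ∀ e p a → ℚᵘ._≃_ (ℚ.toℚᵘ (⟦ e ⟧ p a)) (⟦ e ⟧ᵘ (ℚ.toℚᵘ p) (ℚ.toℚᵘ a))
toℚᵘ-⟦⟧ var₁ p a = ℚᵘP.≃-refl
toℚᵘ-⟦⟧ var₂ p a = ℚᵘP.≃-refl
toℚᵘ-⟦⟧ one p a = ℚᵘP.≃-refl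
toℚᵘ-⟦⟧ half p a = ℚᵘP.≃-refl
toℚᵘ-⟦⟧ (x ⊕ y) p a =
  ℚᵘP.≃-trans (ℚP.toℚᵘ-homo-+ (⟦ x ⟧ p a) (⟦ y ⟧ p a)) (ℚᵘP.+-cong (toℚᵘ-⟦⟧ x p a) (toℚᵘ-⟦⟧ y p a))
toℚᵘ-⟦⟧ (x ⊗ y) p a =
  ℚᵘP.≃-trans (ℚP.toℚᵘ-homo-* (⟦ x ⟧ p a) (⟦ y ⟧ p a)) (ℚᵘP.*-cong (toℚᵘ-⟦⟧ x p a) (toℚᵘ-⟦⟧ y p a))
toℚᵘ-⟦⟧ (x ⊖ y) p a = ℚᵘP.≃-trans (ℚP.toℚᵘ-homo-+ (⟦ x ⟧ p a) (ℚ.- ⟦ y ⟧ p a))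
  (ℚᵘP.+-cong (toℚᵘ-⟦⟧ x p a) (ℚᵘP.≃-trans (ℚP.toℚᵘ-homo‿- (⟦ y ⟧ p a)) (ℚᵘP.-‿cong (toℚᵘ-⟦⟧ y p a))))

num den : Expr → ℤ → ℤ → ℤ → ℤ → ℤ
num var₁ n₁ d₁ n₂ d₂ = n₁
num var₂ n₁ d₁ n₂ d₂ = n₂
num one n₁ d₁ n₂ d₂ = + 1
num half n₁ d₁ n₂ d₂ = + 1
num (x ⊕ y) n₁ d₁ n₂ d₂ = num x n₁ d₁ n₂ d₂ ℤ.* den y n₁ d₁ n₂ d₂ ℤ.+ num y n₁ d₁ n₂ d₂ ℤ.* den x n₁ d₁ n₂ d₂
num (x ⊗ y) n₁ d₁ n₂ d₂ = num x n₁ d₁ n₂ d₂ ℤ.* num y n₁ d₁ n₂ d₂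
num (x ⊖ y) n₁ d₁ n₂ d₂ = num x n₁ d₁ n₂ d₂ ℤ.* den y n₁ d₁ n₂ d₂ ℤ.+ (ℤ.- num y n₁ d₁ n₂ d₂) ℤ.* den x n₁ d₁ n₂ d₂
den var₁ n₁ d₁ n₂ d₂ = d₁
den var₂ n₁ d₁ n₂ d₂ = d₂
den one n₁ d₁ n₂ d₂ = + 1
den half n₁ d₁ n₂ d₂ = + 2
den (x ⊕ y) n₁ d₁ n₂ d₂ = den x n₁ d₁ n₂ d₂ ℤ.* den y n₁ d₁ n₂ d₂
den (x ⊗ y) n₁ d₁ n₂ d₂ = den x n₁ d₁ n₂ d₂ ℤ.* den y n₁ d₁ n₂ d₂
den (x ⊖ y) n₁ d₁ n₂ d₂ = den x n₁ d₁ n₂ d₂ ℤ.* den y n₁ d₁ n₂ d₂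

↥-+ : ∀ p q → ℚᵘ.↥ (p ℚᵘ.+ q) ≡ ℚᵘ.↥ p ℤ.* ℚᵘ.↧ q ℤ.+ ℚᵘ.↥ q ℤ.* ℚᵘ.↧ p
↥-+ (ℚᵘ.mkℚᵘ _ _) (ℚᵘ.mkℚᵘ _ _) = refl

↥-* : ∀ p q → ℚᵘ.↥ (p ℚᵘ.* q) ≡ ℚᵘ.↥ p ℤ.* ℚᵘ.↥ q
↥-* (ℚᵘ.mkℚᵘ _ _) (ℚᵘ.mkℚᵘ _ _) = refl

↥-- : ∀ p q → ℚᵘ.↥ (p ℚᵘ.- q) ≡ ℚᵘ.↥ p ℤ.* ℚᵘ.↧ q ℤ.+ (ℤ.- ℚᵘ.↥ q) ℤ.* ℚᵘ.↧ p
↥-- (ℚᵘ.mkℚᵘ _ _) (ℚᵘ.mkℚᵘ _ _) = refl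

↧-+ : ∀ p q → ℚᵘ.↧ (p ℚᵘ.+ q) ≡ ℚᵘ.↧ p ℤ.* ℚᵘ.↧ q
↧-+ (ℚᵘ.mkℚᵘ _ b) (ℚᵘ.mkℚᵘ _ d) = ℤP.pos-* (suc b) (suc d)

↧-* : ∀ p q → ℚᵘ.↧ (p ℚᵘ.* q) ≡ ℚᵘ.↧ p ℤ.* ℚᵘ.↧ q
↧-* (ℚᵘ.mkℚᵘ _ b) (ℚᵘ.mkℚᵘ _ d) = ℤP.pos-* (suc b) (suc d)

↥-⟦⟧ᵘ : ∀ e p a → ℚᵘ.↥ (⟦ e ⟧ᵘ p a) ≡ num e (ℚᵘ.↥ p) (ℚᵘ.↧ p) (ℚᵘ.↥ a) (ℚᵘ.↧ a)
↧-⟦⟧ᵘ : ∀ e p a → ℚᵘ.↧ (⟦ e ⟧ᵘ p a) ≡ den e (ℚᵘ.↥ p) (ℚᵘ.↧ p) (ℚᵘ.↥ a) (ℚᵘ.↧ a)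
↥-⟦⟧ᵘ var₁ p a = refl
↥-⟦⟧ᵘ var₂ p a = refl
↥-⟦⟧ᵘ one p a = refl
↥-⟦⟧ᵘ half p a = refl
↥-⟦⟧ᵘ (x ⊕ y) p a = trans (↥-+ (⟦ x ⟧ᵘ p a) (⟦ y ⟧ᵘ p a))
  (cong₂ ℤ._+_ (cong₂ ℤ._*_ (↥-⟦⟧ᵘ x p a) (↧-⟦⟧ᵘ y p a)) (cong₂ ℤ._*_ (↥-⟦⟧ᵘ y p a) (↧-⟦⟧ᵘ x p a)))
↥-⟦⟧ᵘ (x ⊗ y) p a = trans (↥-* (⟦ x ⟧ᵘ p a) (⟦ y ⟧ᵘ p a)) (cong₂ ℤ._*_ (↥-⟦⟧ᵘ x p a) (↥-⟦⟧ᵘ y p a))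
↥-⟦⟧ᵘ (x ⊖ y) p a = trans (↥-- (⟦ x ⟧ᵘ p a) (⟦ y ⟧ᵘ p a))
  (cong₂ ℤ._+_ (cong₂ ℤ._*_ (↥-⟦⟧ᵘ x p a) (↧-⟦⟧ᵘ y p a)) (cong₂ ℤ._*_ (cong ℤ.-_ (↥-⟦⟧ᵘ y p a)) (↧-⟦⟧ᵘ x p a)))
↧-⟦⟧ᵘ var₁ p a = refl
↧-⟦⟧ᵘ var₂ p a = refl
↧-⟦⟧ᵘ one p a = refl
↧-⟦⟧ᵘ half p a = refl
↧-⟦⟧ᵘ (x ⊕ y) p a = trans (↧-+ (⟦ x ⟧ᵘ p a) (⟦ y ⟧ᵘ p a)) (cong₂ ℤ._*_ (↧-⟦⟧ᵘ x p a) (↧-⟦⟧ᵘ y p a))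
↧-⟦⟧ᵘ (x ⊗ y) p a = trans (↧-* (⟦ x ⟧ᵘ p a) (⟦ y ⟧ᵘ p a)) (cong₂ ℤ._*_ (↧-⟦⟧ᵘ x p a) (↧-⟦⟧ᵘ y p a))
↧-⟦⟧ᵘ (x ⊖ y) p a = trans (↧-+ (⟦ x ⟧ᵘ p a) (ℚᵘ.- ⟦ y ⟧ᵘ p a)) (cong₂ ℤ._*_ (↧-⟦⟧ᵘ x p a) (trans (↧-neg (⟦ y ⟧ᵘ p a)) (↧-⟦⟧ᵘ y p a)))
  where
  ↧-neg : ∀ q → ℚᵘ.↧ (ℚᵘ.- q) ≡ ℚᵘ.↧ q
  ↧-neg (ℚᵘ.mkℚᵘ _ _) = refl

⟦⟧-<⇒cross : ∀ e₁ e₂ p a → ⟦ e₁ ⟧ p a ℚ.< ⟦ e₂ ⟧ p a →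
  num e₁ (↥ p) (↧ p) (↥ a) (↧ a) ℤ.* den e₂ (↥ p) (↧ p) (↥ a) (↧ a) ℤ.<
  num e₂ (↥ p) (↧ p) (↥ a) (↧ a) ℤ.* den e₁ (↥ p) (↧ p) (↥ a) (↧ a)
⟦⟧-<⇒cross e₁ e₂ p@record{} a@record{} h
  with ℚᵘP.<-respʳ-≃ (toℚᵘ-⟦⟧ e₂ p a) (ℚᵘP.<-respˡ-≃ (toℚᵘ-⟦⟧ e₁ p a) (ℚP.toℚᵘ-mono-< h))
... | ℚᵘ.*<* lt = subst₂ ℤ._<_ (cong₂ ℤ._*_ (↥-⟦⟧ᵘ e₁ P A) (↧-⟦⟧ᵘ e₂ P A)) (cong₂ ℤ._*_ (↥-⟦⟧ᵘ e₂ P A) (↧-⟦⟧ᵘ e₁ P A)) lt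
  where
  P = ℚ.toℚᵘ p
  A = ℚ.toℚᵘ a

cubicRestℤ : ℤ → ℤ → ℤ
cubicRestℤ n d = n ℤ.* n ℤ.* d ℤ.+ n ℤ.* d ℤ.* d ℤ.+ d ℤ.* d ℤ.* d

+-*-* : ∀ x y z → + (x * y * z) ≡ + x ℤ.* + y ℤ.* + z
+-*-* x y z = trans (ℤP.pos-* (x * y) z) (cong (ℤ._* + z) (ℤP.pos-* x y))

+-cube : ∀ c → + cube c ≡ + c ℤ.* + c ℤ.* + c
+-cube c = +-*-* c c c

+-cubicRest : ∀ c d → + cubicRest c d ≡ cubicRestℤ (+ c) (+ d)
+-cubicRest c d = trans (ℤP.pos-+ (c * c * d + c * d * d) (d * d * d))
  (cong₂ ℤ._+_ (trans (ℤP.pos-+ (c * c * d) (c * d * d)) (cong₂ ℤ._+_ (+-*-* c c d) (+-*-* c d d))) (+-*-* d d d))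

-- Multiplying out the cubic condition on n / d leaves a common factor d³.
BelowAlpha⇒ℤ : ∀ n e .(cop : Coprime ℤ.∣ n ∣ (suc e)) → BelowAlpha (mkℚ n e cop) →
  n ℤ.* n ℤ.* n ℤ.< cubicRestℤ n (+ suc e)
BelowAlpha⇒ℤ n e cop h = ℤP.*-cancelʳ-<-nonNeg (+ cube (suc e))
  (subst₂ ℤ._<_ (cong (n ℤ.* n ℤ.* n ℤ.*_) (sym (+-cube (suc e)))) (cong (cubicRestℤ n (+ suc e) ℤ.*_) (sym (+-cube (suc e))))
    (subst₂ ℤ._<_ (lhs n (+ suc e)) (rhs n (+ suc e))
      (⟦⟧-<⇒cross (var₁ ⊗ var₁ ⊗ var₁) (var₁ ⊗ var₁ ⊕ var₁ ⊕ one) q q h)))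
  where
  q = mkℚ n e cop
  lhs : ∀ n d → n ℤ.* n ℤ.* n ℤ.* (d ℤ.* d ℤ.* d ℤ.* ℤ.+ 1) ≡ n ℤ.* n ℤ.* n ℤ.* (d ℤ.* d ℤ.* d)
  lhs = ℤ-Solver.solve-∀
  rhs : ∀ n d → ((n ℤ.* n ℤ.* d ℤ.+ n ℤ.* (d ℤ.* d)) ℤ.* ℤ.+ 1 ℤ.+ ℤ.+ 1 ℤ.* (d ℤ.* d ℤ.* d)) ℤ.* (d ℤ.* d ℤ.* d)
              ≡ (n ℤ.* n ℤ.* d ℤ.+ n ℤ.* d ℤ.* d ℤ.+ d ℤ.* d ℤ.* d) ℤ.* (d ℤ.* d ℤ.* d)
  rhs = ℤ-Solver.solve-∀

AboveAlpha⇒ℤ : ∀ n e .(cop : Coprime ℤ.∣ n ∣ (suc e)) → AboveAlpha (mkℚ n e cop) →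
  cubicRestℤ n (+ suc e) ℤ.< n ℤ.* n ℤ.* n
AboveAlpha⇒ℤ n e cop h = ℤP.*-cancelʳ-<-nonNeg (+ cube (suc e))
  (subst₂ ℤ._<_ (cong (cubicRestℤ n (+ suc e) ℤ.*_) (sym (+-cube (suc e)))) (cong (n ℤ.* n ℤ.* n ℤ.*_) (sym (+-cube (suc e))))
    (subst₂ ℤ._<_ (lhs n (+ suc e)) (rhs n (+ suc e))
      (⟦⟧-<⇒cross (var₁ ⊗ var₁ ⊕ var₁ ⊕ one) (var₁ ⊗ var₁ ⊗ var₁) q q h)))
  where
  q = mkℚ n e cop
  rhs : ∀ n d → n ℤ.* n ℤ.* n ℤ.* (d ℤ.* d ℤ.* d ℤ.* ℤ.+ 1) ≡ n ℤ.* n ℤ.* n ℤ.* (d ℤ.* d ℤ.* d)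
  rhs = ℤ-Solver.solve-∀
  lhs : ∀ n d → ((n ℤ.* n ℤ.* d ℤ.+ n ℤ.* (d ℤ.* d)) ℤ.* ℤ.+ 1 ℤ.+ ℤ.+ 1 ℤ.* (d ℤ.* d ℤ.* d)) ℤ.* (d ℤ.* d ℤ.* d)
              ≡ (n ℤ.* n ℤ.* d ℤ.+ n ℤ.* d ℤ.* d ℤ.+ d ℤ.* d ℤ.* d) ℤ.* (d ℤ.* d ℤ.* d)
  lhs = ℤ-Solver.solve-∀

BelowAlpha⇒cube< : ∀ c e .(cop : Coprime c (suc e)) → BelowAlpha (mkℚ (+ c) e cop) → cube c < cubicRest c (suc e)
BelowAlpha⇒cube< c e cop h =
  ℤP.drop‿+<+ (subst₂ ℤ._<_ (sym (+-cube c)) (sym (+-cubicRest c (suc e))) (BelowAlpha⇒ℤ (+ c) e cop h))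

-- A negative n / d is below α: n³ < 0 ≤ n²d + d³ - |n| d².
AboveAlpha⇒cubicRest< : ∀ n e .(cop : Coprime ℤ.∣ n ∣ (suc e)) → AboveAlpha (mkℚ n e cop) →
  Σ ℕ λ c → n ≡ + c × suc e < c × cubicRest c (suc e) < cube c
AboveAlpha⇒cubicRest< n e cop h = go n (AboveAlpha⇒ℤ n e cop h)
  where
  d = suc e
  go : ∀ n → cubicRestℤ n (+ d) ℤ.< n ℤ.* n ℤ.* n → Σ ℕ λ c → n ≡ + c × d < c × cubicRest c d < cube c
  go (+ c) lt = c , refl , d<c , rest<cube
    where
    rest<cube : cubicRest c d < cube c
    rest<cube = ℤP.drop‿+<+ (subst₂ ℤ._<_ (sym (+-cubicRest c d)) (sym (+-cube c)) lt)
    d<c : d < c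
    d<c with d <? c
    ... | yes d<c = d<c
    ... | no d≮c = ⊥-elim (<⇒≱ rest<cube (≤-trans (*-monoʳ-≤ (c * c) (≮⇒≥ d≮c))
                     (≤-trans (m≤m+n (c * c * d) _) (m≤m+n _ _))))
  go -[1+ m ] lt = ⊥-elim (<⇒≱ lt′ bound)
    where
    x = suc m
    move : ∀ x d → (ℤ.- x) ℤ.* (ℤ.- x) ℤ.* d ℤ.+ (ℤ.- x) ℤ.* d ℤ.* d ℤ.+ d ℤ.* d ℤ.* d ℤ.+ (x ℤ.* d ℤ.* d ℤ.+ x ℤ.* x ℤ.* x)
                 ≡ x ℤ.* x ℤ.* d ℤ.+ d ℤ.* d ℤ.* d ℤ.+ x ℤ.* x ℤ.* x
    move = ℤ-Solver.solve-∀
    move′ : ∀ x d → (ℤ.- x) ℤ.* (ℤ.- x) ℤ.* (ℤ.- x) ℤ.+ (x ℤ.* d ℤ.* d ℤ.+ x ℤ.* x ℤ.* x) ≡ x ℤ.* d ℤ.* d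
    move′ = ℤ-Solver.solve-∀
    lt′ : x * x * d + d * d * d + x * x * x < x * d * d
    lt′ = ℤP.drop‿+<+ (subst₂ ℤ._<_
      (sym (trans (ℤP.pos-+ (x * x * d + d * d * d) _)
        (cong₂ ℤ._+_ (trans (ℤP.pos-+ (x * x * d) _) (cong₂ ℤ._+_ (+-*-* x x d) (+-*-* d d d))) (+-*-* x x x))))
      (sym (+-*-* x d d))
      (subst₂ ℤ._<_ (move (+ x) (+ d)) (move′ (+ x) (+ d)) (ℤP.+-monoˡ-< (+ x ℤ.* + d ℤ.* + d ℤ.+ + x ℤ.* + x ℤ.* + x) lt)))
    bound : x * d * d ≤ x * x * d + d * d * d + x * x * x
    bound with x ≤? d
    ... | yes x≤d = ≤-trans (*-monoˡ-≤ d (*-monoˡ-≤ d x≤d)) (≤-trans (m≤n+m _ (x * x * d)) (m≤m+n _ _))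
    ... | no x≰d = ≤-trans (*-mono-≤ (*-monoʳ-≤ x d≤x) d≤x) (m≤n+m (x * x * x) (x * x * d + d * d * d))
      where
      d≤x = <⇒≤ (≰⇒> x≰d)

<-half[sq+1]⇒ℤ : ∀ p a → a ℚ.< ℚ.½ ℚ.* (p ℚ.* p ℚ.+ ℚ.1ℚ) →
  ↥ a ℤ.* (+ 2 ℤ.* ↧ p ℤ.* ↧ p) ℤ.< (↥ p ℤ.* ↥ p ℤ.+ ↧ p ℤ.* ↧ p) ℤ.* ↧ a
<-half[sq+1]⇒ℤ p a h =
  subst₂ ℤ._<_ (lhs (↥ a) (↧ p)) (rhs (↥ p) (↧ p) (↧ a)) (⟦⟧-<⇒cross var₂ (half ⊗ (var₁ ⊗ var₁ ⊕ one)) p a h)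
  where
  lhs : ∀ s d → s ℤ.* (ℤ.+ 2 ℤ.* (d ℤ.* d ℤ.* ℤ.+ 1)) ≡ s ℤ.* (ℤ.+ 2 ℤ.* d ℤ.* d)
  lhs = ℤ-Solver.solve-∀
  rhs : ∀ n d t → ℤ.+ 1 ℤ.* (n ℤ.* n ℤ.* ℤ.+ 1 ℤ.+ ℤ.+ 1 ℤ.* (d ℤ.* d)) ℤ.* t ≡ (n ℤ.* n ℤ.+ d ℤ.* d) ℤ.* t
  rhs = ℤ-Solver.solve-∀

half[sq+1]-<⇒ℤ : ∀ q b → ℚ.½ ℚ.* (q ℚ.* q ℚ.+ ℚ.1ℚ) ℚ.< b →
  (↥ q ℤ.* ↥ q ℤ.+ ↧ q ℤ.* ↧ q) ℤ.* ↧ b ℤ.< ↥ b ℤ.* (+ 2 ℤ.* ↧ q ℤ.* ↧ q)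
half[sq+1]-<⇒ℤ q b h =
  subst₂ ℤ._<_ (lhs (↥ q) (↧ q) (↧ b)) (rhs (↥ b) (↧ q)) (⟦⟧-<⇒cross (half ⊗ (var₁ ⊗ var₁ ⊕ one)) var₂ q b h)
  where
  rhs : ∀ s d → s ℤ.* (ℤ.+ 2 ℤ.* (d ℤ.* d ℤ.* ℤ.+ 1)) ≡ s ℤ.* (ℤ.+ 2 ℤ.* d ℤ.* d)
  rhs = ℤ-Solver.solve-∀
  lhs : ∀ n d t → ℤ.+ 1 ℤ.* (n ℤ.* n ℤ.* ℤ.+ 1 ℤ.+ ℤ.+ 1 ℤ.* (d ℤ.* d)) ℤ.* t ≡ (n ℤ.* n ℤ.+ d ℤ.* d) ℤ.* t
  lhs = ℤ-Solver.solve-∀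

*[q-1]<⇒ℤ : ∀ q a → a ℚ.* (q ℚ.- ℚ.1ℚ) ℚ.< q → ↥ a ℤ.* (↥ q ℤ.- ↧ q) ℤ.< ↥ q ℤ.* ↧ a
*[q-1]<⇒ℤ q@(mkℚ n e _) a h = ℤP.*-cancelʳ-<-nonNeg (+ suc e)
  (subst₂ ℤ._<_ (lhs (↥ a) n (+ suc e)) (rhs n (↧ a) (+ suc e)) (⟦⟧-<⇒cross (var₂ ⊗ (var₁ ⊖ one)) var₁ q a h))
  where
  lhs : ∀ s n d → s ℤ.* (n ℤ.* ℤ.+ 1 ℤ.+ (ℤ.- ℤ.+ 1) ℤ.* d) ℤ.* d ≡ s ℤ.* (n ℤ.- d) ℤ.* d
  lhs = ℤ-Solver.solve-∀
  rhs : ∀ n t d → n ℤ.* (t ℤ.* (d ℤ.* ℤ.+ 1)) ≡ n ℤ.* t ℤ.* d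
  rhs = ℤ-Solver.solve-∀

<*[p-1]⇒ℤ : ∀ p b → p ℚ.< b ℚ.* (p ℚ.- ℚ.1ℚ) → ↥ p ℤ.* ↧ b ℤ.< ↥ b ℤ.* (↥ p ℤ.- ↧ p)
<*[p-1]⇒ℤ p@(mkℚ n e _) b h = ℤP.*-cancelʳ-<-nonNeg (+ suc e)
  (subst₂ ℤ._<_ (lhs n (↧ b) (+ suc e)) (rhs (↥ b) n (+ suc e)) (⟦⟧-<⇒cross var₁ (var₂ ⊗ (var₁ ⊖ one)) p b h))
  where
  rhs : ∀ s n d → s ℤ.* (n ℤ.* ℤ.+ 1 ℤ.+ (ℤ.- ℤ.+ 1) ℤ.* d) ℤ.* d ≡ s ℤ.* (n ℤ.- d) ℤ.* d
  rhs = ℤ-Solver.solve-∀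
  lhs : ∀ n t d → n ℤ.* (t ℤ.* (d ℤ.* ℤ.+ 1)) ≡ n ℤ.* t ℤ.* d
  lhs = ℤ-Solver.solve-∀

1<⇒numerator : ∀ n e .(cop : Coprime ℤ.∣ n ∣ (suc e)) → ℚ.1ℚ ℚ.< mkℚ n e cop → Σ ℕ λ c → n ≡ + c × suc e < c
1<⇒numerator n e cop h = go n (subst₂ ℤ._<_ (ℤP.*-identityˡ (+ suc e)) (ℤP.*-identityʳ n)
                                  (⟦⟧-<⇒cross one var₁ (mkℚ n e cop) (mkℚ n e cop) h))
  where
  go : ∀ n → + suc e ℤ.< n → Σ ℕ λ c → n ≡ + c × suc e < c
  go (+ c) lt = c , refl , ℤP.drop‿+<+ lt

0≤⇒numerator : ∀ n e .(cop : Coprime ℤ.∣ n ∣ (suc e)) → ℚ.0ℚ ℚ.≤ mkℚ n e cop → Σ ℕ λ c → n ≡ + c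
0≤⇒numerator (+ c) e cop _ = c , refl
0≤⇒numerator -[1+ m ] e cop (ℚ.*≤* ())

-- ↥ and ↧ of m / (1 + k) are those of the fraction divided by their gcd.
ℤ⇒<-/ : ∀ a m k → ↥ a ℤ.* + suc k ℤ.< + m ℤ.* ↧ a → a ℚ.< + m ℚ./ suc k
ℤ⇒<-/ a m k h = ℚ.*<* (ℤP.*-cancelʳ-<-nonNeg g (subst₂ ℤ._<_ lhs rhs h))
  where
  g = gcdℤ (+ m) (+ suc k)
  lhs : ↥ a ℤ.* + suc k ≡ ↥ a ℤ.* ↧ (+ m ℚ./ suc k) ℤ.* g
  lhs = trans (cong (↥ a ℤ.*_) (sym (ℚP.↧-/ (+ m) (suc k)))) (sym (ℤP.*-assoc (↥ a) _ g))
  rhs : + m ℤ.* ↧ a ≡ ↥ (+ m ℚ./ suc k) ℤ.* ↧ a ℤ.* g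
  rhs = trans (cong (ℤ._* ↧ a) (sym (ℚP.↥-/ (+ m) (suc k)))) (swap (↥ (+ m ℚ./ suc k)) g (↧ a))
    where
    swap : ∀ x y z → x ℤ.* y ℤ.* z ≡ x ℤ.* z ℤ.* y
    swap = ℤ-Solver.solve-∀

ℤ⇒/-< : ∀ b m k → + m ℤ.* ↧ b ℤ.< ↥ b ℤ.* + suc k → + m ℚ./ suc k ℚ.< b
ℤ⇒/-< b m k h = ℚ.*<* (ℤP.*-cancelʳ-<-nonNeg g (subst₂ ℤ._<_ lhs rhs h))
  where
  g = gcdℤ (+ m) (+ suc k)
  rhs : ↥ b ℤ.* + suc k ≡ ↥ b ℤ.* ↧ (+ m ℚ./ suc k) ℤ.* g
  rhs = trans (cong (↥ b ℤ.*_) (sym (ℚP.↧-/ (+ m) (suc k)))) (sym (ℤP.*-assoc (↥ b) _ g))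
  lhs : + m ℤ.* ↧ b ≡ ↥ (+ m ℚ./ suc k) ℤ.* ↧ b ℤ.* g
  lhs = trans (cong (ℤ._* ↧ b) (sym (ℚP.↥-/ (+ m) (suc k)))) (swap (↥ (+ m ℚ./ suc k)) g (↧ b))
    where
    swap : ∀ x y z → x ℤ.* y ℤ.* z ≡ x ℤ.* z ℤ.* y
    swap = ℤ-Solver.solve-∀

-- The limit of g r / r

Eventually-× : ∀ {P Q : ℕ → Set} → Eventually P → Eventually Q → Eventually (λ n → P n × Q n)
Eventually-× (R , p) (S , q) = R ⊔ S , λ n le → p n (≤-trans (m≤m⊔n R S) le) , q n (≤-trans (m≤n⊔m R S) le)

-- T (3 + n) / T (2 + n) ≤ (d + y) / d  iff  count (T (3 + n)) / T (3 + n) ≤ y / (d + y)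
RatioAtMost⇒count-upper : ∀ d y n → 1 ≤ n → RatioAtMost (d + y) d (2 + n) → (d + y) * count (T (3 + n)) ≤ y * T (3 + n)
RatioAtMost⇒count-upper d y n 1≤n h = +-cancelʳ-≤ ((d + y) * T (2 + n)) _ _ (begin
  (d + y) * count (T (3 + n)) + (d + y) * T (2 + n) ≡⟨ *-distribˡ-+ (d + y) _ _ ⟨
  (d + y) * (count (T (3 + n)) + T (2 + n))         ≡⟨ cong ((d + y) *_) (T[3+n]≡count+T[2+n] n 1≤n) ⟨
  (d + y) * T (3 + n)                               ≡⟨ *-distribʳ-+ (T (3 + n)) d y ⟩
  d * T (3 + n) + y * T (3 + n)                     ≤⟨ +-monoˡ-≤ (y * T (3 + n)) h ⟩
  (d + y) * T (2 + n) + y * T (3 + n)               ≡⟨ +-comm ((d + y) * T (2 + n)) _ ⟩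
  y * T (3 + n) + (d + y) * T (2 + n)               ∎)

RatioAtLeast⇒count-lower : ∀ d y n → 1 ≤ n → RatioAtLeast (d + y) d (2 + n) → y * T (3 + n) ≤ (d + y) * count (T (3 + n))
RatioAtLeast⇒count-lower d y n 1≤n h = +-cancelʳ-≤ ((d + y) * T (2 + n)) _ _ (begin
  y * T (3 + n) + (d + y) * T (2 + n)               ≤⟨ +-monoʳ-≤ (y * T (3 + n)) h ⟩
  y * T (3 + n) + d * T (3 + n)                     ≡⟨ +-comm (y * T (3 + n)) _ ⟩
  d * T (3 + n) + y * T (3 + n)                     ≡⟨ *-distribʳ-+ (T (3 + n)) d y ⟨
  (d + y) * T (3 + n)                               ≡⟨ cong ((d + y) *_) (T[3+n]≡count+T[2+n] n 1≤n) ⟩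
  (d + y) * (count (T (3 + n)) + T (2 + n))         ≡⟨ *-distribˡ-+ (d + y) _ _ ⟩
  (d + y) * count (T (3 + n)) + (d + y) * T (2 + n) ∎)

ℤ-+-cancelʳ-< : ∀ u v w → u ℤ.+ w ℤ.< v ℤ.+ w → u ℤ.< v
ℤ-+-cancelʳ-< u v w h = subst₂ ℤ._<_ (e u w) (e v w) (ℤP.+-monoˡ-< (ℤ.- w) h)
  where
  e : ∀ u w → u ℤ.+ w ℤ.+ ℤ.- w ≡ u
  e = ℤ-Solver.solve-∀

<-ratio-of-bound : ∀ (s : ℤ) (t y c g K m : ℕ) → 1 ≤ y → s ℤ.* + y ℤ.< + c ℤ.* + t →
  c * m ≤ y * g + K → K * t < m → s ℤ.* + m ℤ.< + g ℤ.* + t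
<-ratio-of-bound s t y c g K m 1≤y h₁ h₂ h₃ = ℤP.*-cancelʳ-<-nonNeg (+ y)
  (ℤ-+-cancelʳ-< _ _ (+ m) (ℤP.≤-<-trans step (ℤP.+-monoʳ-< (+ g ℤ.* + t ℤ.* + y) Kt<m)))
  where
  Kt<m : + t ℤ.* + K ℤ.< + m
  Kt<m = subst (ℤ._< + m) (trans (ℤP.pos-* K t) (ℤP.*-comm (+ K) (+ t))) (ℤ.+<+ h₃)
  h₂′ : + c ℤ.* + m ℤ.≤ + y ℤ.* + g ℤ.+ + K
  h₂′ = subst₂ ℤ._≤_ (ℤP.pos-* c m) (trans (ℤP.pos-+ (y * g) K) (cong (ℤ._+ + K) (ℤP.pos-* y g))) (ℤ.+≤+ h₂)
  step : s ℤ.* + m ℤ.* + y ℤ.+ + m ℤ.≤ + g ℤ.* + t ℤ.* + y ℤ.+ + t ℤ.* + K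
  step = subst₂ ℤ._≤_ (sym (e₁ s (+ m) (+ y))) (e₃ (+ t) (+ y) (+ g) (+ K))
    (ℤP.≤-trans (ℤP.*-monoʳ-≤-nonNeg (+ m) (ℤP.i<j⇒suc[i]≤j h₁))
      (subst (ℤ._≤ _) (sym (e₂ (+ c) (+ t) (+ m))) (ℤP.*-monoˡ-≤-nonNeg (+ t) h₂′)))
    where
    e₁ : ∀ s m y → s ℤ.* m ℤ.* y ℤ.+ m ≡ (ℤ.+ 1 ℤ.+ s ℤ.* y) ℤ.* m
    e₁ = ℤ-Solver.solve-∀
    e₂ : ∀ c t m → c ℤ.* t ℤ.* m ≡ t ℤ.* (c ℤ.* m)
    e₂ = ℤ-Solver.solve-∀
    e₃ : ∀ t y g K → t ℤ.* (y ℤ.* g ℤ.+ K) ≡ g ℤ.* t ℤ.* y ℤ.+ t ℤ.* K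
    e₃ = ℤ-Solver.solve-∀

ratio-<-of-bound : ∀ (s : ℤ) (t y c g K m : ℕ) → 1 ≤ y → + c ℤ.* + t ℤ.< s ℤ.* + y →
  y * g ≤ c * m + K → K * t < m → + g ℤ.* + t ℤ.< s ℤ.* + m
ratio-<-of-bound s t y c g K m 1≤y h₁ h₂ h₃ = ℤP.*-cancelʳ-<-nonNeg (+ y) (ℤ-+-cancelʳ-< _ _ (+ m) step)
  where
  Kt<m : + t ℤ.* + K ℤ.< + m
  Kt<m = subst (ℤ._< + m) (trans (ℤP.pos-* K t) (ℤP.*-comm (+ K) (+ t))) (ℤ.+<+ h₃)
  h₂′ : + y ℤ.* + g ℤ.≤ + c ℤ.* + m ℤ.+ + K
  h₂′ = subst₂ ℤ._≤_ (ℤP.pos-* y g) (trans (ℤP.pos-+ (c * m) K) (cong (ℤ._+ + K) (ℤP.pos-* c m))) (ℤ.+≤+ h₂)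
  step : + g ℤ.* + t ℤ.* + y ℤ.+ + m ℤ.< s ℤ.* + m ℤ.* + y ℤ.+ + m
  step = subst₂ ℤ._<_ (sym (e₁ (+ g) (+ t) (+ y) (+ m))) (e₃ s (+ y) (+ m))
    (ℤP.≤-<-trans (ℤP.+-monoˡ-≤ (+ m) (ℤP.*-monoˡ-≤-nonNeg (+ t) h₂′))
      (subst (ℤ._< _) (sym (e₂ (+ t) (+ c) (+ m) (+ K)))
        (ℤP.<-≤-trans (ℤP.+-monoʳ-< (ℤ.suc (+ c ℤ.* + t) ℤ.* + m) Kt<m)
          (ℤP.+-monoˡ-≤ (+ m) (ℤP.*-monoʳ-≤-nonNeg (+ m) (ℤP.i<j⇒suc[i]≤j h₁))))))
    where
    e₁ : ∀ g t y m → g ℤ.* t ℤ.* y ℤ.+ m ≡ t ℤ.* (y ℤ.* g) ℤ.+ m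
    e₁ = ℤ-Solver.solve-∀
    e₂ : ∀ t c m K → t ℤ.* (c ℤ.* m ℤ.+ K) ℤ.+ m ≡ (ℤ.+ 1 ℤ.+ c ℤ.* t) ℤ.* m ℤ.+ t ℤ.* K
    e₂ = ℤ-Solver.solve-∀
    e₃ : ∀ s y m → s ℤ.* y ℤ.* m ℤ.+ m ≡ s ℤ.* m ℤ.* y ℤ.+ m
    e₃ = ℤ-Solver.solve-∀

-- With x = c / d, the number X = (c² + d²) / (c² − d²) satisfies
-- X / (X − 1) = (x² + 1) / 2, and x ↦ X fixes α and reverses the order.
flipWeight : ℕ → ℕ → ℕ
flipWeight d s = 2 * (d * d * d) + 4 * (d * d * s) + 4 * (d * s * s) + s * s * s

1≤flipWeight : ∀ {d} s → 1 ≤ d → 1 ≤ flipWeight d s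
1≤flipWeight s 1≤d = ≤-trans (1≤cube 1≤d) (≤-trans (m≤m+n _ _) (≤-trans (m≤m+n _ _) (≤-trans (m≤m+n _ _) (m≤m+n _ _))))

flip-identity : ∀ d s → let e = s * (2 * d + s) ; f = 2 * d * d in
  cubicRest (e + f) e + 2 * cubicRest (d + s) d * flipWeight d s ≡ cube (e + f) + 2 * cube (d + s) * flipWeight d s
flip-identity = identity
  where
  identity : ∀ d s → let e = s * (2 * d + s) ; f = 2 * d * d ; c = d + s
                         W = 2 * (d * d * d) + 4 * (d * d * s) + 4 * (d * s * s) + s * s * s in
    (e + f) * (e + f) * e + (e + f) * e * e + e * e * e + 2 * (c * c * d + c * d * d + d * d * d) * W
    ≡ (e + f) * (e + f) * (e + f) + 2 * (c * c * c) * W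
  identity = solve-∀

flip-below : ∀ d s → 1 ≤ d → let e = s * (2 * d + s) ; f = 2 * d * d in
  cube (d + s) < cubicRest (d + s) d → cubicRest (e + f) e < cube (e + f)
flip-below d s 1≤d lt = +-cancelʳ-< _ _ _ (begin-strict
  cubicRest (e + f) e + 2 * cubicRest (d + s) d * W ≡⟨ flip-identity d s ⟩
  cube (e + f) + 2 * cube (d + s) * W               <⟨ +-monoʳ-< (cube (e + f)) (*-monoˡ-< W {{>-nonZero (1≤flipWeight s 1≤d)}} (*-monoʳ-< 2 lt)) ⟩
  cube (e + f) + 2 * cubicRest (d + s) d * W        ∎)
  where
  e = s * (2 * d + s)
  f = 2 * d * d
  W = flipWeight d s

flip-above : ∀ d s → 1 ≤ d → let e = s * (2 * d + s) ; f = 2 * d * d in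
  cubicRest (d + s) d < cube (d + s) → cube (e + f) < cubicRest (e + f) e
flip-above d s 1≤d lt = +-cancelʳ-< _ _ _ (begin-strict
  cube (e + f) + 2 * cubicRest (d + s) d * W        <⟨ +-monoʳ-< (cube (e + f)) (*-monoˡ-< W {{>-nonZero (1≤flipWeight s 1≤d)}} (*-monoʳ-< 2 lt)) ⟩
  cube (e + f) + 2 * cube (d + s) * W               ≡⟨ flip-identity d s ⟨
  cubicRest (e + f) e + 2 * cubicRest (d + s) d * W ∎)
  where
  e = s * (2 * d + s)
  f = 2 * d * d
  W = flipWeight d s

+[d+y]-+d≡+y : ∀ d y → + (d + y) ℤ.- + d ≡ + y
+[d+y]-+d≡+y d y = trans (cong (ℤ._- + d) (ℤP.pos-+ d y)) (e (+ d) (+ y))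
  where
  e : ∀ a b → a ℤ.+ b ℤ.- a ≡ b
  e = ℤ-Solver.solve-∀

+-sum-of-squares : ∀ d s → + (s * (2 * d + s) + 2 * d * d) ≡ + (d + s) ℤ.* + (d + s) ℤ.+ + d ℤ.* + d
+-sum-of-squares d s = trans (cong +_ (e d s)) (trans (ℤP.pos-+ ((d + s) * (d + s)) (d * d))
  (cong₂ ℤ._+_ (ℤP.pos-* (d + s) (d + s)) (ℤP.pos-* d d)))
  where
  e : ∀ d s → s * (2 * d + s) + 2 * d * d ≡ (d + s) * (d + s) + d * d
  e = solve-∀

d<d+y⇒1≤y : ∀ {d y} → d < d + y → 1 ≤ y
d<d+y⇒1≤y {d} {zero} lt = ⊥-elim (<-irrefl (sym (+-identityʳ d)) lt)
d<d+y⇒1≤y {d} {suc y} _ = s≤s z≤n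

1≤σ[2d+σ] : ∀ d σ → 1 ≤ σ → 1 ≤ σ * (2 * d + σ)
1≤σ[2d+σ] d σ 1≤σ = *-mono-≤ {1} {σ} {1} 1≤σ (≤-trans 1≤σ (m≤n+m σ (2 * d)))

1≤2dd : ∀ d → 1 ≤ d → 1 ≤ 2 * d * d
1≤2dd d 1≤d = *-mono-≤ {1} {2 * d} {1} {d} (*-mono-≤ {1} {2} {1} {d} (s≤s z≤n) 1≤d) 1≤d

module Enumeration (g : ℕ → ℕ)
  (g-inc : (r : ℕ) → 1 ≤ r → g r < g (suc r))
  (g-enum : (N : ℕ) → ((0 < N × EndsIn1 N) → Σ ℕ λ r → 1 ≤ r × g r ≡ N)
                    × ((Σ ℕ λ r → 1 ≤ r × g r ≡ N) → (0 < N × EndsIn1 N))) where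

  g-suc-mono-≤ : ∀ {r s} → r ≤ s → g (suc r) ≤ g (suc s)
  g-suc-mono-≤ = suc-mono⇒mono-≤ (λ r → g (suc r)) (λ r → <⇒≤ (g-inc (suc r) (s≤s z≤n)))

  g-suc-cancel-< : ∀ {r s} → g (suc r) < g (suc s) → r < s
  g-suc-cancel-< {r} {s} lt with r <? s
  ... | yes r<s = r<s
  ... | no r≮s = ⊥-elim (<⇒≱ lt (g-suc-mono-≤ (≮⇒≥ r≮s)))

  EndsIn1-g : ∀ r → EndsIn1 (g (suc r))
  EndsIn1-g r = proj₂ (proj₂ (g-enum _) (suc r , s≤s z≤n , refl))

  g-onto : ∀ j → EndsIn1 j → Σ ℕ λ r → g (suc r) ≡ j
  g-onto j e with proj₁ (g-enum j) (EndsIn1⇒0< e , e)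
  ... | suc r , _ , eq = r , eq

  count∘g : ∀ r → count (g (suc r)) ≡ suc r
  count∘g zero = count-next 0 (g 1) (EndsIn1⇒0< (EndsIn1-g 0)) gap (EndsIn1-g 0)
    where
    gap : ∀ j → 0 < j → j < g 1 → ¬ EndsIn1 j
    gap j _ j<g e with g-onto j e
    ... | s , refl = ⊥-elim (<⇒≱ (g-suc-cancel-< {s} {0} j<g) z≤n)
  count∘g (suc r) = trans (count-next (g (suc r)) (g (2 + r)) (g-inc (suc r) (s≤s z≤n)) gap (EndsIn1-g (suc r)))
                          (cong suc (count∘g r))
    where
    gap : ∀ j → g (suc r) < j → j < g (2 + r) → ¬ EndsIn1 j
    gap j lo hi e with g-onto j e
    ... | s , refl = ⊥-elim (<⇒≱ (g-suc-cancel-< {s} {suc r} hi) (g-suc-cancel-< {r} {s} lo))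

  r≤g[r] : ∀ r → suc r ≤ g (suc r)
  r≤g[r] r = subst (_≤ g (suc r)) (count∘g r) (count≤id (g (suc r)))
  -- (d + y) / d > α gives (d + y) count N ≤ y N + K, so g r / r eventually
  -- exceeds every a < (d + y) / y.
  ratio-eventually-above : ∀ d y a → 1 ≤ d → 1 ≤ y → cubicRest (d + y) d < cube (d + y) →
    ↥ a ℤ.* + y ℤ.< + (d + y) ℤ.* ↧ a → Eventually (λ k → a ℚ.< ratio g k)
  ratio-eventually-above d y a 1≤d 1≤y above h with RatioAtMost-eventually (d + y) d 1≤d above
  ... | R , ratio≤ = K * ℚ.↧ₙ a , λ k le →
    ℤ⇒<-/ a (g (suc k)) k (<-ratio-of-bound (↥ a) (ℚ.↧ₙ a) y (d + y) (g (suc k)) K (suc k) 1≤y h (bound k) (s≤s le))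
    where
    K = (d + y) * T (4 + R)
    bound : ∀ k → (d + y) * suc k ≤ y * g (suc k) + K
    bound k = subst (λ r → (d + y) * r ≤ y * g (suc k) + K) (count∘g k)
      (count-upper (d + y) y (suc R) (s≤s z≤n)
        (λ n R<n → RatioAtMost⇒count-upper d y n (≤-trans (s≤s z≤n) R<n) (ratio≤ (2 + n) (≤-trans (n≤1+n R) (≤-trans R<n (m≤n+m n 2)))))
        (g (suc k)))

  ratio-eventually-below : ∀ d y b → 1 ≤ d → 1 ≤ y → cube (d + y) < cubicRest (d + y) d →
    + (d + y) ℤ.* ↧ b ℤ.< ↥ b ℤ.* + y → Eventually (λ k → ratio g k ℚ.< b)
  ratio-eventually-below d y b 1≤d 1≤y below h with RatioAtLeast-eventually (d + y) d 1≤d below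
  ... | R , ratio≥ = K * ℚ.↧ₙ b , λ k le →
    ℤ⇒/-< b (g (suc k)) k (ratio-<-of-bound (↥ b) (ℚ.↧ₙ b) y (d + y) (g (suc k)) K (suc k) 1≤y h (bound k) (s≤s le))
    where
    K = y * T (4 + R)
    bound : ∀ k → y * g (suc k) ≤ (d + y) * suc k + K
    bound k = subst (λ r → y * g (suc k) ≤ (d + y) * r + K) (count∘g k)
      (count-lower (d + y) y (suc R) (s≤s z≤n)
        (λ n R<n → RatioAtLeast⇒count-lower d y n (≤-trans (s≤s z≤n) R<n) (ratio≥ (2 + n) (≤-trans (n≤1+n R) (≤-trans R<n (m≤n+m n 2)))))
        (g (suc k)))

  <1⇒<ratio : ∀ a → ↥ a ℤ.< ↧ a → Eventually (λ k → a ℚ.< ratio g k)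
  <1⇒<ratio a a<1 = 0 , λ k _ → ℤ⇒<-/ a (g (suc k)) k
    (ℤP.<-≤-trans (ℤP.*-monoʳ-<-pos (+ suc k) a<1)
      (subst (+ ℚ.↧ₙ a ℤ.* + suc k ℤ.≤_) (ℤP.*-comm (+ ℚ.↧ₙ a) (+ g (suc k)))
        (ℤP.*-monoˡ-≤-nonNeg (+ ℚ.↧ₙ a) (ℤ.+≤+ (r≤g[r] k)))))

  BelowL₂-eventually : ∀ a → BelowL₂ a → Eventually (λ k → a ℚ.< ratio g k)
  BelowL₂-eventually a (mkℚ n e cop , above , _ , h) with AboveAlpha⇒cubicRest< n e cop above
  ... | c , refl , d<c , lt with m≤n⇒∃[o]m+o≡n (<⇒≤ d<c)
  ... | y , refl = ratio-eventually-above (suc e) y a (s≤s z≤n) (d<d+y⇒1≤y d<c) lt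
    (subst (λ z → ↥ a ℤ.* z ℤ.< + (suc e + y) ℤ.* ↧ a) (+[d+y]-+d≡+y (suc e) y) (*[q-1]<⇒ℤ (mkℚ (+ (suc e + y)) e cop) a h))

  AboveL₂-eventually : ∀ b → AboveL₂ b → Eventually (λ k → ratio g k ℚ.< b)
  AboveL₂-eventually b (mkℚ n e cop , below , 1<p , h) with 1<⇒numerator n e cop 1<p
  ... | c , refl , d<c with m≤n⇒∃[o]m+o≡n (<⇒≤ d<c)
  ... | y , refl = ratio-eventually-below (suc e) y b (s≤s z≤n) (d<d+y⇒1≤y d<c) (BelowAlpha⇒cube< (suc e + y) e cop below)
    (subst (λ z → + (suc e + y) ℤ.* ↧ b ℤ.< ↥ b ℤ.* z) (+[d+y]-+d≡+y (suc e) y) (<*[p-1]⇒ℤ (mkℚ (+ (suc e + y)) e cop) b h))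

  BelowL₁-eventually : ∀ a → BelowL₁ a → Eventually (λ k → a ℚ.< ratio g k)
  BelowL₁-eventually a (mkℚ n e cop , 0≤p , below , h) with 0≤⇒numerator n e cop 0≤p
  ... | c , refl with suc e <? c
  ...   | yes d<c with m≤n⇒∃[o]m+o≡n (<⇒≤ d<c)
  ...     | σ , refl = ratio-eventually-above E F a (1≤σ[2d+σ] d σ 1≤σ) (1≤2dd d (s≤s z≤n)) (flip-below d σ (s≤s z≤n) (BelowAlpha⇒cube< c e cop below))
              (subst₂ (λ u v → ↥ a ℤ.* u ℤ.< v ℤ.* ↧ a) (sym (+-*-* 2 d d)) (sym (+-sum-of-squares d σ))
                (<-half[sq+1]⇒ℤ (mkℚ (+ c) e cop) a h))
    where
    d = suc e
    E = σ * (2 * d + σ)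
    F = 2 * d * d
    1≤σ = d<d+y⇒1≤y d<c
  BelowL₁-eventually a (mkℚ n e cop , 0≤p , below , h) | c , refl | no d≮c = <1⇒<ratio a
    (ℤP.*-cancelʳ-<-nonNeg (+ (2 * d * d)) (subst₂ ℤ._<_ (cong (↥ a ℤ.*_) (sym (+-*-* 2 d d))) (double (↧ a) (+ d))
      (ℤP.<-≤-trans (<-half[sq+1]⇒ℤ (mkℚ (+ c) e cop) a h) (ℤP.*-monoʳ-≤-nonNeg (↧ a) c²+d²≤2d²))))
    where
    d = suc e
    c²+d²≤2d² : + c ℤ.* + c ℤ.+ + d ℤ.* + d ℤ.≤ + d ℤ.* + d ℤ.+ + d ℤ.* + d
    c²+d²≤2d² = ℤP.+-monoˡ-≤ (+ d ℤ.* + d) (subst₂ ℤ._≤_ (ℤP.pos-* c c) (ℤP.pos-* d d) (ℤ.+≤+ (*-mono-≤ (≮⇒≥ d≮c) (≮⇒≥ d≮c))))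
    double : ∀ t d → (d ℤ.* d ℤ.+ d ℤ.* d) ℤ.* t ≡ t ℤ.* (ℤ.+ 2 ℤ.* d ℤ.* d)
    double = ℤ-Solver.solve-∀

  AboveL₁-eventually : ∀ b → AboveL₁ b → Eventually (λ k → ratio g k ℚ.< b)
  AboveL₁-eventually b (mkℚ n e cop , above , h) with AboveAlpha⇒cubicRest< n e cop above
  ... | c , refl , d<c , lt with m≤n⇒∃[o]m+o≡n (<⇒≤ d<c)
  ... | σ , refl = ratio-eventually-below E F b (1≤σ[2d+σ] d σ 1≤σ) (1≤2dd d (s≤s z≤n)) (flip-above d σ (s≤s z≤n) lt)
        (subst₂ (λ u v → u ℤ.* ↧ b ℤ.< ↥ b ℤ.* v) (sym (+-sum-of-squares d σ)) (sym (+-*-* 2 d d))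
          (half[sq+1]-<⇒ℤ (mkℚ (+ (d + σ)) e cop) b h))
    where
    d = suc e
    E = σ * (2 * d + σ)
    F = 2 * d * d
    1≤σ = d<d+y⇒1≤y d<c

mainTheorem5 : (g : ℕ → ℕ)
    → ((r : ℕ) → 1 ≤ r → g r < g (suc r))
    → ((N : ℕ) → ((0 < N × EndsIn1 N) → Σ ℕ λ r → 1 ≤ r × g r ≡ N)
    × ((Σ ℕ λ r → 1 ≤ r × g r ≡ N) → (0 < N × EndsIn1 N)))
    → ConvergesTo (ratio g) BelowL₁ AboveL₁ × ConvergesTo (ratio g) BelowL₂ AboveL₂
mainTheorem5 g g-inc g-enum =
  (λ a b a<L b>L → Eventually-× (BelowL₁-eventually a a<L) (AboveL₁-eventually b b>L)) ,
  (λ a b a<L b>L → Eventually-× (BelowL₂-eventually a a<L) (AboveL₂-eventually b b>L))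
  where open Enumeration g g-inc g-enum
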